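{- We have the identities $$X_{8, 2}' = 2X_{4, 2} X_{6, 1},\quad X_{10, 2}' = \tfrac{8}{9} X_{4, 2} X_{8, 1} + \tfrac{10}{9} X_{6, 1}^2,\quad X_{12, 2}' = 3 X_{6, 1} X_{8, 2},\quad X_{14, 2}' = 3 X_{4, 2} X_{12, 1}.$$ In particular, $X_{w, 2}$ is completely positive for every even $w$ with $4\le w \leq 14$, $w\neq 6$.
   Context: Let $q=e^{2\pi i z}$, $E_2 = 1 - 24\sum_{n\ge1}\sigma_1(n)q^n$, $E_4 = 1+240\sum_{n\ge1}\sigma_3(n)q^n$, $E_6 = 1-504\sum_{n\ge1}\sigma_5(n)q^n$. Quasimodular forms for $\mathrm{SL}_2(\mathbb{Z})$ are the elements of $\mathbb{C}[E_2,E_4,E_6]$, graded by weight; depth is the degree in $E_2$; $\mathcal{QM}_w^s$ is the space of weight $w$, depth $\le s$. A form $f\in\mathcal{QM}_w^s\setminus\mathcal{QM}_w^{s-1}$ with $q$-expansion $\sum_{n\ge0}a_nq^n$ is extremal if, with $m=\dim_{\mathbb{C}}\mathcal{QM}_w^s$, $a_0=\dots=a_{m-2}=0$ and $a_{m-1}\ne0$; normalized means the first nonzero coefficient is $1$. $X_{w,s}$ denotes the unique normalized extremal form of weight $w$ and depth $s$ (it exists and is unique for depth $1$ with even $w\ge6$ and depth $2$ with even $w\ge4$, $w\ne6$). Explicitly $X_{4,2}=(E_4-E_2^2)/288$, $X_{6,1}=(E_2E_4-E_6)/720$, $X_{8,1}=(E_4^2-E_2E_6)/1008$, $X_{12,1}=(-12E_2E_4E_6+5E_4^3+7E_6^2)/3991680$,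 $X_{8,2}=(-7E_2^2E_4+2E_2E_6+5E_4^2)/362880$, $X_{10,2}=(5E_2^2E_6+2E_2E_4^2-7E_4E_6)/1088640$, $X_{12,2}=(-77E_2^2E_4^2+34E_2E_4E_6+50E_4^3-7E_6^2)/798336000$, $X_{14,2}=(13E_2^2E_4E_6+E_2E_4^3-3E_2E_6^2-11E_4^2E_6)/415134720$. $X'=q\frac{dX}{dq}$. A form is completely positive if all its Fourier coefficients are real and nonnegative. -}

module Defs where

open import Data.Nat as ℕ using (ℕ; zero; suc)
open import Data.Nat.Divisibility using (_∣?_)
open import Data.Integer using (+_)
open import Data.Rational using (ℚ; 0ℚ; 1ℚ; _+_; _*_; -_; _-_; _/_; _≤_)
open import Data.List using (List; upTo; map)
open import Data.Nat.ListAction using (sum)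
open import Relation.Nullary.Decidable using (does)
open import Data.Bool using (if_then_else_)
open import Relation.Binary.PropositionalEquality using (_≡_)

-- Formal power series in q with rational coefficients:
-- a series f stands for  Σ_{n ≥ 0} f n q^n.
Series : Set
Series = ℕ → ℚ

⟦_⟧ : ℕ → ℚ
⟦ n ⟧ = + n / 1

-- σ_k(n) = Σ_{d ∣ n, 1 ≤ d ≤ n} d^k   (for n ≥ 1; σ_k(0) = 0, unused)
σ : ℕ → ℕ → ℕ
σ k n = sum (map (λ i → let d = suc i in if does (d ∣? n) then d ℕ.^ k else 0) (upTo n))

_⊕_ : Series → Series → Series
(f ⊕ g) n = f n + g n

_⊖_ : Series → Series → Series
(f ⊖ g) n = f n - g n

_·_ : ℚ → Series → Series
(c · f) n = c * f n

_⊗_ : Series → Series → Series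
(f ⊗ g) n = Data.List.foldr _+_ 0ℚ (map (λ i → f i * g (n ℕ.∸ i)) (upTo (suc n)))

infixl 6 _⊕_ _⊖_
infixl 7 _⊗_
infixr 8 _·_

-- X' = q dX/dq
D : Series → Series
D f n = ⟦ n ⟧ * f n

E₂ E₄ E₆ : Series
E₂ zero = 1ℚ
E₂ (suc n) = - (⟦ 24 ⟧ * ⟦ σ 1 (suc n) ⟧)
E₄ zero = 1ℚ
E₄ (suc n) = ⟦ 240 ⟧ * ⟦ σ 3 (suc n) ⟧
E₆ zero = 1ℚ
E₆ (suc n) = - (⟦ 504 ⟧ * ⟦ σ 5 (suc n) ⟧)

X₄₂ X₆₁ X₈₁ X₁₂₁ X₈₂ X₁₀₂ X₁₂₂ X₁₄₂ : Series
X₄₂ = (+ 1 / 288) · (E₄ ⊖ E₂ ⊗ E₂)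
X₆₁ = (+ 1 / 720) · (E₂ ⊗ E₄ ⊖ E₆)
X₈₁ = (+ 1 / 1008) · (E₄ ⊗ E₄ ⊖ E₂ ⊗ E₆)
X₁₂₁ = (+ 1 / 3991680) ·
  (⟦ 5 ⟧ · E₄ ⊗ E₄ ⊗ E₄ ⊕ ⟦ 7 ⟧ · E₆ ⊗ E₆ ⊖ ⟦ 12 ⟧ · E₂ ⊗ E₄ ⊗ E₆)
X₈₂ = (+ 1 / 362880) ·
  (⟦ 2 ⟧ · E₂ ⊗ E₆ ⊕ ⟦ 5 ⟧ · E₄ ⊗ E₄ ⊖ ⟦ 7 ⟧ · E₂ ⊗ E₂ ⊗ E₄)
X₁₀₂ = (+ 1 / 1088640) ·
  (⟦ 5 ⟧ · E₂ ⊗ E₂ ⊗ E₆ ⊕ ⟦ 2 ⟧ · E₂ ⊗ E₄ ⊗ E₄ ⊖ ⟦ 7 ⟧ · E₄ ⊗ E₆)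
X₁₂₂ = (+ 1 / 798336000) ·
  (⟦ 34 ⟧ · E₂ ⊗ E₄ ⊗ E₆ ⊕ ⟦ 50 ⟧ · E₄ ⊗ E₄ ⊗ E₄
    ⊖ ⟦ 77 ⟧ · E₂ ⊗ E₂ ⊗ E₄ ⊗ E₄ ⊖ ⟦ 7 ⟧ · E₆ ⊗ E₆)
X₁₄₂ = (+ 1 / 415134720) ·
  (⟦ 13 ⟧ · E₂ ⊗ E₂ ⊗ E₄ ⊗ E₆ ⊕ E₂ ⊗ E₄ ⊗ E₄ ⊗ E₄
    ⊖ ⟦ 3 ⟧ · E₂ ⊗ E₆ ⊗ E₆ ⊖ ⟦ 11 ⟧ · E₄ ⊗ E₄ ⊗ E₆)

_≋_ : Series → Series → Set
f ≋ g = ∀ n → f n ≡ g n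

-- all Fourier coefficients (rational, hence real) are nonnegative
CompletelyPositive : Series → Set
CompletelyPositive f = ∀ n → 0ℚ ≤ f n

-- Ramanujan's equations D E₂ = (E₂² − E₄)/12, D E₄ = (E₂E₄ − E₆)/3, D E₆ = (E₂E₆ − E₄²)/2 make
-- ℚ[E₂, E₄, E₆] closed under D, so after pushing D through sums and products each identity is a
-- polynomial identity in E₂, E₄, E₆, checked by the ring solver.  Coefficientwise, Ramanujan's
-- equations are the classical evaluations of the convolution sums σ₁⋆σ₁, σ₁⋆σ₃ and
-- 12096 σ₁⋆σ₅ − 57600 σ₃⋆σ₃, proved by Liouville's elementary method: the sum of f(a, b, x, y)
-- over the positive solutions of ax + by = n collapses onto the solutions of a(x + y) = n, hence
-- onto divisor sums, whenever f satisfies a suitable functional equation.  Each evaluation comes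
-- with explicit polynomials certifying that functional equation and a discrete antiderivative.
--
-- X₄₂, X₆₁ and X₈₁ are positive multiples of −D E₂, D E₄ and −D E₆, whose coefficients are
-- positive multiples of n σₖ(n).  A series with completely positive derivative and nonnegative
-- constant term is completely positive, and the identities (with D X₁₂₁ = 2 X₆₁ X₈₁) express
-- each D X_{w,2} through products of series already known to be completely positive.

module Submission where

open import Defs

open import Algebra.Bundles using (CommutativeMonoid; CommutativeRing)
open import Algebra.Structures using (IsCommutativeRing)
open import Data.Bool.Base using (if_then_else_)
open import Data.Fin as Fin using (#_)
open import Data.Integer.Base as ℤ using (+_)
import Data.Integer.Properties as ℤₚ
open import Data.List.Base using (List; []; _∷_; foldr; map; applyUpTo)
open import Data.Maybe.Base using (Maybe; just; nothing)
open import Data.Nat as ℕ using (ℕ; zero; suc; _∸_; z≤n; s≤s)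
open import Data.Nat.Divisibility using (_∣_; _∣?_; divides; ∣1⇒≡1)
open import Data.Nat.ListAction using (sum)
import Data.Nat.Properties as ℕₚ
open import Data.Nat.Solver using () renaming (module +-*-Solver to ℕ-Solver)
open import Data.Product.Base using (_×_; _,_)
open import Data.Rational.Base
  using (ℚ; 0ℚ; 1ℚ; ½; _+_; _*_; -_; _-_; _/_; _≤_; toℚᵘ; nonNegative; +-*-rawSemiring; +-*-rawRing)
import Data.Rational.Properties as ℚₚ
open import Data.Rational.Solver using (module +-*-Solver)
import Data.Rational.Unnormalised.Base as ℚᵘ
import Data.Rational.Unnormalised.Properties as ℚᵘₚ
open import Data.Sum.Base using (_⊎_; inj₁; inj₂)
open import Data.Vec.Base using (Vec; []; _∷_)
open import Function.Base using (_∘_)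
open import Level using (0ℓ)
open import Relation.Binary.Definitions using (tri<; tri≈; tri>)
open import Relation.Binary.PropositionalEquality
open import Relation.Nullary.Decidable using (Dec; yes; no; does; True; toWitness)
open import Relation.Nullary.Negation using (¬_; contradiction)

open import Algebra.Definitions.RawSemiring +-*-rawSemiring using (_^_)
open +-*-Solver using (Polynomial; solve; _:=_; _:+_; _:*_; _:-_; :-_; _:^_; con; var) renaming (⟦_⟧ to ⟦_⟧ₚ)
open ℕ-Solver using () renaming (solve to ℕ-solve; _:=_ to _ℕ:=_; _:+_ to _ℕ:+_; _:*_ to _ℕ:*_)
open import Algebra.Properties.CommutativeSemigroup (CommutativeMonoid.commutativeSemigroup ℚₚ.*-1-commutativeMonoid)
  using (x∙yz≈y∙xz)
open ≡-Reasoning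

private
  ⟦⟧-toℚᵘ : ∀ n → toℚᵘ ⟦ n ⟧ ℚᵘ.≃ ℚᵘ.mkℚᵘ (+ n) 0
  ⟦⟧-toℚᵘ n = ℚᵘₚ.≃-reflexive (cong toℚᵘ (ℚₚ.normalize-coprime {n} {0} λ (_ , d∣1) → ∣1⇒≡1 d∣1))

⟦⟧-+ : ∀ m n → ⟦ m ℕ.+ n ⟧ ≡ ⟦ m ⟧ + ⟦ n ⟧
⟦⟧-+ m n = ℚₚ.toℚᵘ-injective (ℚᵘₚ.≃-trans (⟦⟧-toℚᵘ (m ℕ.+ n)) (ℚᵘₚ.≃-trans (ℚᵘ.*≡* numerators)
  (ℚᵘₚ.≃-sym (ℚᵘₚ.≃-trans (ℚₚ.toℚᵘ-homo-+ ⟦ m ⟧ ⟦ n ⟧) (ℚᵘₚ.+-cong (⟦⟧-toℚᵘ m) (⟦⟧-toℚᵘ n))))))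
  where
  numerators : + (m ℕ.+ n) ℤ.* + 1 ≡ (+ m ℤ.* + 1 ℤ.+ + n ℤ.* + 1) ℤ.* + 1
  numerators = cong (ℤ._* + 1) (trans (ℤₚ.pos-+ m n) (sym (cong₂ ℤ._+_ (ℤₚ.*-identityʳ (+ m)) (ℤₚ.*-identityʳ (+ n)))))

⟦⟧-* : ∀ m n → ⟦ m ℕ.* n ⟧ ≡ ⟦ m ⟧ * ⟦ n ⟧
⟦⟧-* m n = ℚₚ.toℚᵘ-injective (ℚᵘₚ.≃-trans (⟦⟧-toℚᵘ (m ℕ.* n)) (ℚᵘₚ.≃-trans (ℚᵘ.*≡* numerators)
  (ℚᵘₚ.≃-sym (ℚᵘₚ.≃-trans (ℚₚ.toℚᵘ-homo-* ⟦ m ⟧ ⟦ n ⟧) (ℚᵘₚ.*-cong (⟦⟧-toℚᵘ m) (⟦⟧-toℚᵘ n))))))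
  where
  numerators : + (m ℕ.* n) ℤ.* + 1 ≡ (+ m ℤ.* + n) ℤ.* + 1
  numerators = cong (ℤ._* + 1) (ℤₚ.pos-* m n)

⟦⟧-∸ : ∀ {m n} → n ℕ.≤ m → ⟦ m ∸ n ⟧ ≡ ⟦ m ⟧ - ⟦ n ⟧
⟦⟧-∸ {m} {n} n≤m = begin
  ⟦ m ∸ n ⟧                  ≡⟨ solve 2 (λ p q → p := p :+ q :- q) refl ⟦ m ∸ n ⟧ ⟦ n ⟧ ⟩
  ⟦ m ∸ n ⟧ + ⟦ n ⟧ - ⟦ n ⟧  ≡⟨ cong (_- ⟦ n ⟧) (⟦⟧-+ (m ∸ n) n) ⟨
  ⟦ m ∸ n ℕ.+ n ⟧ - ⟦ n ⟧    ≡⟨ cong (λ k → ⟦ k ⟧ - ⟦ n ⟧) (ℕₚ.m∸n+n≡m n≤m) ⟩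
  ⟦ m ⟧ - ⟦ n ⟧              ∎

⟦⟧-suc : ∀ n → ⟦ suc n ⟧ ≡ ⟦ n ⟧ + 1ℚ
⟦⟧-suc n = trans (cong ⟦_⟧ (ℕₚ.+-comm 1 n)) (⟦⟧-+ n 1)

⟦⟧-^ : ∀ d k → ⟦ d ℕ.^ k ⟧ ≡ ⟦ d ⟧ ^ k
⟦⟧-^ d zero    = refl
⟦⟧-^ d (suc k) = trans (⟦⟧-* d (d ℕ.^ k)) (cong (⟦ d ⟧ *_) (⟦⟧-^ d k))

⟦⟧-nonNeg : ∀ n → 0ℚ ≤ ⟦ n ⟧
⟦⟧-nonNeg n = ℚₚ.nonNegative⁻¹ ⟦ n ⟧ {{ℚₚ.normalize-nonNeg n 1}}

∑ : ℕ → (ℕ → ℚ) → ℚ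
∑ zero    f = 0ℚ
∑ (suc n) f = f 0 + ∑ n (λ i → f (suc i))

∑₁ : ℕ → (ℕ → ℚ) → ℚ
∑₁ n f = ∑ n (λ i → f (suc i))

∑-cong : ∀ n {f g : ℕ → ℚ} → (∀ i → f i ≡ g i) → ∑ n f ≡ ∑ n g
∑-cong zero    _ = refl
∑-cong (suc n) f≗g = cong₂ _+_ (f≗g 0) (∑-cong n (λ i → f≗g (suc i)))

∑-cong< : ∀ n {f g : ℕ → ℚ} → (∀ i → i ℕ.< n → f i ≡ g i) → ∑ n f ≡ ∑ n g
∑-cong< zero    _ = refl
∑-cong< (suc n) f≗g = cong₂ _+_ (f≗g 0 (s≤s z≤n)) (∑-cong< n (λ i i<n → f≗g (suc i) (s≤s i<n)))

∑-+ : ∀ n (f g : ℕ → ℚ) → ∑ n (λ i → f i + g i) ≡ ∑ n f + ∑ n g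
∑-+ zero    f g = refl
∑-+ (suc n) f g = begin
  f 0 + g 0 + ∑ n (λ i → f (suc i) + g (suc i))
    ≡⟨ cong (_+_ (f 0 + g 0)) (∑-+ n (λ i → f (suc i)) (λ i → g (suc i))) ⟩
  f 0 + g 0 + (∑ n (λ i → f (suc i)) + ∑ n (λ i → g (suc i)))
    ≡⟨ solve 4 (λ a b c d → a :+ b :+ (c :+ d) := a :+ c :+ (b :+ d)) refl (f 0) (g 0) _ _ ⟩
  f 0 + ∑ n (λ i → f (suc i)) + (g 0 + ∑ n (λ i → g (suc i)))  ∎

∑-*ˡ : ∀ n c (f : ℕ → ℚ) → ∑ n (λ i → c * f i) ≡ c * ∑ n f
∑-*ˡ zero    c f = sym (ℚₚ.*-zeroʳ c)
∑-*ˡ (suc n) c f = trans (cong (_+_ (c * f 0)) (∑-*ˡ n c (λ i → f (suc i)))) (sym (ℚₚ.*-distribˡ-+ c (f 0) _))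

∑-*ʳ : ∀ n c (f : ℕ → ℚ) → ∑ n (λ i → f i * c) ≡ ∑ n f * c
∑-*ʳ n c f = trans (∑-cong n (λ i → ℚₚ.*-comm (f i) c)) (trans (∑-*ˡ n c f) (ℚₚ.*-comm c _))

∑-zero : ∀ n (f : ℕ → ℚ) → (∀ i → i ℕ.< n → f i ≡ 0ℚ) → ∑ n f ≡ 0ℚ
∑-zero zero    f _ = refl
∑-zero (suc n) f f≗0 = trans (cong₂ _+_ (f≗0 0 (s≤s z≤n)) (∑-zero n (λ i → f (suc i)) (λ i i<n → f≗0 (suc i) (s≤s i<n))))
                             (ℚₚ.+-identityˡ 0ℚ)

∑-swap : ∀ m n (f : ℕ → ℕ → ℚ) → ∑ m (λ i → ∑ n (f i)) ≡ ∑ n (λ j → ∑ m (λ i → f i j))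
∑-swap zero    n f = sym (∑-zero n (λ _ → 0ℚ) (λ _ _ → refl))
∑-swap (suc m) n f = begin
  ∑ n (f 0) + ∑ m (λ i → ∑ n (f (suc i)))            ≡⟨ cong (_+_ (∑ n (f 0))) (∑-swap m n (λ i → f (suc i))) ⟩
  ∑ n (f 0) + ∑ n (λ j → ∑ m (λ i → f (suc i) j))    ≡⟨ ∑-+ n (f 0) _ ⟨
  ∑ n (λ j → ∑ (suc m) (λ i → f i j))                ∎

∑-last : ∀ n (f : ℕ → ℚ) → ∑ (suc n) f ≡ ∑ n f + f n
∑-last zero    f = trans (ℚₚ.+-identityʳ (f 0)) (sym (ℚₚ.+-identityˡ (f 0)))
∑-last (suc n) f = trans (cong (_+_ (f 0)) (∑-last n (λ i → f (suc i)))) (sym (ℚₚ.+-assoc (f 0) _ _))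

∑-split : ∀ m n (f : ℕ → ℚ) → ∑ (m ℕ.+ n) f ≡ ∑ m f + ∑ n (λ i → f (m ℕ.+ i))
∑-split zero    n f = sym (ℚₚ.+-identityˡ _)
∑-split (suc m) n f = trans (cong (_+_ (f 0)) (∑-split m n (λ i → f (suc i)))) (sym (ℚₚ.+-assoc (f 0) _ _))

∑-reverse : ∀ n (f : ℕ → ℚ) → ∑ (suc n) f ≡ ∑ (suc n) (λ i → f (n ∸ i))
∑-reverse zero    f = refl
∑-reverse (suc n) f = begin
  f 0 + ∑ (suc n) (λ i → f (suc i))                    ≡⟨ cong (_+_ (f 0)) (∑-reverse n (λ i → f (suc i))) ⟩
  f 0 + ∑ (suc n) (λ i → f (suc (n ∸ i)))              ≡⟨ ℚₚ.+-comm (f 0) _ ⟩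
  ∑ (suc n) (λ i → f (suc (n ∸ i))) + f 0              ≡⟨ cong₂ _+_ (∑-cong< (suc n) (λ i i≤n → cong f (sym (ℕₚ.+-∸-assoc 1 (ℕₚ.≤-pred i≤n)))))
                                                                    (cong f (sym (ℕₚ.n∸n≡0 n))) ⟩
  ∑ (suc n) (λ i → f (suc n ∸ i)) + f (suc n ∸ suc n)  ≡⟨ ∑-last (suc n) (λ i → f (suc n ∸ i)) ⟨
  ∑ (suc (suc n)) (λ i → f (suc n ∸ i))                ∎

∑-triangle : ∀ n (F : ℕ → ℕ → ℚ) →
             ∑ (suc n) (λ i → ∑ (suc (n ∸ i)) (F i)) ≡ ∑ (suc n) (λ k → ∑ (suc k) (λ i → F i (k ∸ i)))
∑-triangle zero    F = refl
∑-triangle (suc n) F = begin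
  ∑ (suc (suc n)) (F 0) + ∑ (suc n) (λ i → ∑ (suc (n ∸ i)) (F (suc i)))
    ≡⟨ cong (_+_ (∑ (suc (suc n)) (F 0))) (∑-triangle n (λ i → F (suc i))) ⟩
  ∑ (suc (suc n)) (F 0) + ∑ (suc n) (λ k → ∑ (suc k) (λ i → F (suc i) (k ∸ i)))
    ≡⟨ cong (_+_ (∑ (suc (suc n)) (F 0))) (ℚₚ.+-identityˡ _) ⟨
  ∑ (suc (suc n)) (F 0) + ∑ (suc (suc n)) (λ k → ∑ k (λ i → F (suc i) (k ∸ suc i)))
    ≡⟨ ∑-+ (suc (suc n)) (F 0) (λ k → ∑ k (λ i → F (suc i) (k ∸ suc i))) ⟨
  ∑ (suc (suc n)) (λ k → ∑ (suc k) (λ i → F i (k ∸ i)))  ∎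

∑-nonNeg : ∀ n (f : ℕ → ℚ) → (∀ i → 0ℚ ≤ f i) → 0ℚ ≤ ∑ n f
∑-nonNeg zero    f _ = ℚₚ.≤-refl
∑-nonNeg (suc n) f f≥0 = ℚₚ.+-mono-≤ (f≥0 0) (∑-nonNeg n (λ i → f (suc i)) (λ i → f≥0 (suc i)))

𝟙 : ∀ {P : Set} → Dec P → ℚ
𝟙 p = if does p then 1ℚ else 0ℚ

𝟙-yes : ∀ {P : Set} (p : Dec P) → P → 𝟙 p ≡ 1ℚ
𝟙-yes (yes _) _  = refl
𝟙-yes (no ¬p) p  = contradiction p ¬p

𝟙-no : ∀ {P : Set} (p : Dec P) → ¬ P → 𝟙 p ≡ 0ℚ
𝟙-no (yes p) ¬p = contradiction p ¬p
𝟙-no (no _)  _  = refl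

𝟙-⇔ : ∀ {P Q : Set} (p : Dec P) (q : Dec Q) → (P → Q) → (Q → P) → 𝟙 p ≡ 𝟙 q
𝟙-⇔ p q P⇒Q Q⇒P with p
... | yes x = sym (𝟙-yes q (P⇒Q x))
... | no ¬x = sym (𝟙-no q (λ y → ¬x (Q⇒P y)))

δ : ℕ → ℕ → ℚ
δ m n = 𝟙 (m ℕ.≟ n)

δ< : ℕ → ℕ → ℚ
δ< m n = 𝟙 (m ℕ.<? n)

δ-refl : ∀ n → δ n n ≡ 1ℚ
δ-refl n = 𝟙-yes (n ℕ.≟ n) refl

δ*-≢ : ∀ {m n} F → m ≢ n → δ m n * F ≡ 0ℚ
δ*-≢ {m} {n} F m≢n = trans (cong (_* F) (𝟙-no (m ℕ.≟ n) m≢n)) (ℚₚ.*-zeroˡ F)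

δ*-cong : ∀ m n {F G : ℚ} → (m ≡ n → F ≡ G) → δ m n * F ≡ δ m n * G
δ*-cong m n {F} {G} F≡G with m ℕ.≟ n
... | yes m≡n = cong (δ m n *_) (F≡G m≡n)
... | no m≢n  = trans (δ*-≢ F m≢n) (sym (δ*-≢ G m≢n))

δ-sym : ∀ m n → δ m n ≡ δ n m
δ-sym m n = 𝟙-⇔ (m ℕ.≟ n) (n ℕ.≟ m) sym sym

∑₁-cong : ∀ N {f g : ℕ → ℚ} → (∀ j → 1 ℕ.≤ j → j ℕ.≤ N → f j ≡ g j) → ∑₁ N f ≡ ∑₁ N g
∑₁-cong N f≗g = ∑-cong< N (λ i i<N → f≗g (suc i) (s≤s z≤n) i<N)

∑₁-zero : ∀ N (f : ℕ → ℚ) → (∀ j → 1 ℕ.≤ j → j ℕ.≤ N → f j ≡ 0ℚ) → ∑₁ N f ≡ 0ℚ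
∑₁-zero N f f≗0 = ∑-zero N (λ i → f (suc i)) (λ i i<N → f≗0 (suc i) (s≤s z≤n) i<N)

∑₁-split : ∀ c N (g : ℕ → ℚ) → ∑₁ (c ℕ.+ N) g ≡ ∑₁ c g + ∑₁ N (λ j → g (c ℕ.+ j))
∑₁-split c N g = trans (∑-split c N (λ i → g (suc i))) (cong (_+_ (∑₁ c g)) (∑-cong N (λ i → cong g (sym (ℕₚ.+-suc c i)))))

∑₁-extend : ∀ {N M} (g : ℕ → ℚ) → N ℕ.≤ M → (∀ j → N ℕ.< j → g j ≡ 0ℚ) → ∑₁ M g ≡ ∑₁ N g
∑₁-extend {N} {M} g N≤M g≗0 = begin
  ∑₁ M g                                    ≡⟨ cong (λ K → ∑₁ K g) (ℕₚ.m+[n∸m]≡n N≤M) ⟨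
  ∑₁ (N ℕ.+ (M ∸ N)) g                      ≡⟨ ∑₁-split N (M ∸ N) g ⟩
  ∑₁ N g + ∑₁ (M ∸ N) (λ j → g (N ℕ.+ j))   ≡⟨ cong (_+_ (∑₁ N g)) (∑₁-zero (M ∸ N) _ λ j 1≤j _ → g≗0 (N ℕ.+ j) (ℕₚ.m<m+n N 1≤j)) ⟩
  ∑₁ N g + 0ℚ                               ≡⟨ ℚₚ.+-identityʳ (∑₁ N g) ⟩
  ∑₁ N g                                    ∎

∑₁-swap : ∀ M N (f : ℕ → ℕ → ℚ) → ∑₁ M (λ i → ∑₁ N (f i)) ≡ ∑₁ N (λ j → ∑₁ M (λ i → f i j))
∑₁-swap M N f = ∑-swap M N (λ i j → f (suc i) (suc j))

∑₁-+ : ∀ N (f g : ℕ → ℚ) → ∑₁ N (λ i → f i + g i) ≡ ∑₁ N f + ∑₁ N g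
∑₁-+ N f g = ∑-+ N (λ i → f (suc i)) (λ i → g (suc i))

∑₁-*ˡ : ∀ N c (f : ℕ → ℚ) → ∑₁ N (λ i → c * f i) ≡ c * ∑₁ N f
∑₁-*ˡ N c f = ∑-*ˡ N c (λ i → f (suc i))

∑₁-δ : ∀ N c (h : ℕ → ℚ) → 1 ℕ.≤ c → c ℕ.≤ N → ∑₁ N (λ j → δ j c * h j) ≡ h c
∑₁-δ zero    c h 1≤c c≤0 = contradiction (ℕₚ.≤-trans 1≤c c≤0) λ ()
∑₁-δ (suc N) c h 1≤c c≤N with c ℕ.≟ suc N
... | yes refl = begin
  ∑₁ (suc N) (λ j → δ j c * h j)          ≡⟨ ∑-last N (λ i → δ (suc i) c * h (suc i)) ⟩
  ∑₁ N (λ j → δ j c * h j) + δ c c * h c  ≡⟨ cong₂ _+_ (∑₁-zero N _ (λ j _ j≤N → δ*-≢ (h j) (ℕₚ.<⇒≢ (s≤s j≤N))))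
                                                       (trans (cong (_* h c) (δ-refl c)) (ℚₚ.*-identityˡ (h c))) ⟩
  0ℚ + h c                                ≡⟨ ℚₚ.+-identityˡ (h c) ⟩
  h c                                     ∎
... | no c≢ = begin
  ∑₁ (suc N) (λ j → δ j c * h j)                            ≡⟨ ∑-last N (λ i → δ (suc i) c * h (suc i)) ⟩
  ∑₁ N (λ j → δ j c * h j) + δ (suc N) c * h (suc N)        ≡⟨ cong₂ _+_ (∑₁-δ N c h 1≤c (ℕₚ.≤-pred (ℕₚ.≤∧≢⇒< c≤N c≢)))
                                                                         (δ*-≢ (h (suc N)) (c≢ ∘ sym)) ⟩
  h c + 0ℚ                                                  ≡⟨ ℚₚ.+-identityʳ (h c) ⟩
  h c                                                       ∎

∑₁-δ-outside : ∀ N c (h : ℕ → ℚ) → N ℕ.< c → ∑₁ N (λ j → δ j c * h j) ≡ 0ℚ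
∑₁-δ-outside N c h N<c = ∑₁-zero N (λ j → δ j c * h j) (λ j _ j≤N → δ*-≢ {j} {c} (h j) (λ { refl → ℕₚ.<⇒≱ N<c j≤N }))

∑₁-δ< : ∀ N c (h : ℕ → ℚ) → (∀ j → N ℕ.< j → h j ≡ 0ℚ) → ∑₁ N (λ j → δ< c j * h j) ≡ ∑₁ N (λ j → h (c ℕ.+ j))
∑₁-δ< N c h h≗0 = begin
  ∑₁ N (λ j → δ< c j * h j)
    ≡⟨ ∑₁-extend (λ j → δ< c j * h j) (ℕₚ.m≤n+m N c) (λ j N<j → trans (cong (δ< c j *_) (h≗0 j N<j)) (ℚₚ.*-zeroʳ (δ< c j))) ⟨
  ∑₁ (c ℕ.+ N) (λ j → δ< c j * h j)
    ≡⟨ ∑₁-split c N (λ j → δ< c j * h j) ⟩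
  ∑₁ c (λ j → δ< c j * h j) + ∑₁ N (λ j → δ< c (c ℕ.+ j) * h (c ℕ.+ j))
    ≡⟨ cong₂ _+_ (∑₁-zero c _ (λ j _ j≤c → trans (cong (_* h j) (𝟙-no (c ℕ.<? j) (ℕₚ.≤⇒≯ j≤c))) (ℚₚ.*-zeroˡ (h j))))
                 (∑₁-cong N (λ j 1≤j _ → trans (cong (_* h (c ℕ.+ j)) (𝟙-yes (c ℕ.<? c ℕ.+ j) (ℕₚ.m<m+n c 1≤j)))
                                              (ℚₚ.*-identityˡ (h (c ℕ.+ j))))) ⟩
  0ℚ + ∑₁ N (λ j → h (c ℕ.+ j))
    ≡⟨ ℚₚ.+-identityˡ _ ⟩
  ∑₁ N (λ j → h (c ℕ.+ j))  ∎

∑₁-trichotomy : ∀ N c (h : ℕ → ℚ) →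
                ∑₁ N h ≡ ∑₁ N (λ j → δ< j c * h j) + ∑₁ N (λ j → δ j c * h j) + ∑₁ N (λ j → δ< c j * h j)
∑₁-trichotomy N c h = begin
  ∑₁ N h
    ≡⟨ ∑-cong N (λ i → split (suc i)) ⟩
  ∑₁ N (λ j → δ< j c * h j + δ j c * h j + δ< c j * h j)
    ≡⟨ ∑₁-+ N (λ j → δ< j c * h j + δ j c * h j) (λ j → δ< c j * h j) ⟩
  ∑₁ N (λ j → δ< j c * h j + δ j c * h j) + ∑₁ N (λ j → δ< c j * h j)
    ≡⟨ cong (_+ ∑₁ N (λ j → δ< c j * h j)) (∑₁-+ N (λ j → δ< j c * h j) (λ j → δ j c * h j)) ⟩
  ∑₁ N (λ j → δ< j c * h j) + ∑₁ N (λ j → δ j c * h j) + ∑₁ N (λ j → δ< c j * h j)  ∎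
  where
  partition : ∀ j → δ< j c + δ j c + δ< c j ≡ 1ℚ
  partition j with ℕₚ.<-cmp j c
  ... | tri< j<c j≢c j≯c = cong₂ _+_ (cong₂ _+_ (𝟙-yes (j ℕ.<? c) j<c) (𝟙-no (j ℕ.≟ c) j≢c)) (𝟙-no (c ℕ.<? j) j≯c)
  ... | tri≈ j≮c refl j≯c = cong₂ _+_ (cong₂ _+_ (𝟙-no (j ℕ.<? j) j≮c) (δ-refl j)) (𝟙-no (j ℕ.<? j) j≯c)
  ... | tri> j≮c j≢c j>c = cong₂ _+_ (cong₂ _+_ (𝟙-no (j ℕ.<? c) j≮c) (𝟙-no (j ℕ.≟ c) j≢c)) (𝟙-yes (c ℕ.<? j) j>c)
  split : ∀ j → h j ≡ δ< j c * h j + δ j c * h j + δ< c j * h j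
  split j = begin
    h j                                           ≡⟨ ℚₚ.*-identityˡ (h j) ⟨
    1ℚ * h j                                      ≡⟨ cong (_* h j) (partition j) ⟨
    (δ< j c + δ j c + δ< c j) * h j               ≡⟨ solve 4 (λ a b d x → (a :+ b :+ d) :* x := a :* x :+ b :* x :+ d :* x) refl
                                                           (δ< j c) (δ j c) (δ< c j) (h j) ⟩
    δ< j c * h j + δ j c * h j + δ< c j * h j     ∎

-- Formal power series and the derivation D

∑-foldr : ∀ m (h : ℕ → ℚ) (g : ℕ → ℕ) → foldr _+_ 0ℚ (map h (applyUpTo g m)) ≡ ∑ m (λ i → h (g i))
∑-foldr zero    h g = refl
∑-foldr (suc m) h g = cong (_+_ (h (g 0))) (∑-foldr m h (λ i → g (suc i)))

⊗-∑ : ∀ f g n → (f ⊗ g) n ≡ ∑ (suc n) (λ i → f i * g (n ∸ i))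
⊗-∑ f g n = ∑-foldr (suc n) (λ i → f i * g (n ∸ i)) (λ i → i)

constant : ℚ → Series
constant c zero    = c
constant c (suc n) = 0ℚ

neg : Series → Series
neg f n = - f n

-- A record rather than _≋_ itself, so that both series can be recovered from the type
-- (needed by the ring solver).
infix 4 _≈_
record _≈_ (f g : Series) : Set where
  constructor mk≈
  field coeffwise : f ≋ g
open _≈_ public

≈-refl : ∀ {f} → f ≈ f
≈-refl = mk≈ λ n → refl

≈-sym : ∀ {f g} → f ≈ g → g ≈ f
≈-sym (mk≈ e) = mk≈ λ n → sym (e n)

≈-trans : ∀ {f g h} → f ≈ g → g ≈ h → f ≈ h
≈-trans (mk≈ e) (mk≈ e′) = mk≈ λ n → trans (e n) (e′ n)

⊕-cong : ∀ {f f′ g g′} → f ≈ f′ → g ≈ g′ → f ⊕ g ≈ f′ ⊕ g′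
⊕-cong (mk≈ e) (mk≈ e′) = mk≈ λ n → cong₂ _+_ (e n) (e′ n)

⊖-cong : ∀ {f f′ g g′} → f ≈ f′ → g ≈ g′ → f ⊖ g ≈ f′ ⊖ g′
⊖-cong (mk≈ e) (mk≈ e′) = mk≈ λ n → cong₂ _-_ (e n) (e′ n)

·-cong : ∀ {c f g} → f ≈ g → c · f ≈ c · g
·-cong {c} (mk≈ e) = mk≈ λ n → cong (c *_) (e n)

⊗-cong : ∀ {f f′ g g′} → f ≈ f′ → g ≈ g′ → f ⊗ g ≈ f′ ⊗ g′
⊗-cong {f} {f′} {g} {g′} (mk≈ e) (mk≈ e′) = mk≈ λ n → begin
  (f ⊗ g) n                              ≡⟨ ⊗-∑ f g n ⟩
  ∑ (suc n) (λ i → f i * g (n ∸ i))      ≡⟨ ∑-cong (suc n) (λ i → cong₂ _*_ (e i) (e′ (n ∸ i))) ⟩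
  ∑ (suc n) (λ i → f′ i * g′ (n ∸ i))    ≡⟨ ⊗-∑ f′ g′ n ⟨
  (f′ ⊗ g′) n                            ∎

neg-cong : ∀ {f f′} → f ≈ f′ → neg f ≈ neg f′
neg-cong (mk≈ e) = mk≈ λ n → cong -_ (e n)

⊗-comm : ∀ f g → f ⊗ g ≈ g ⊗ f
⊗-comm f g = mk≈ λ n → begin
  (f ⊗ g) n                                          ≡⟨ ⊗-∑ f g n ⟩
  ∑ (suc n) (λ i → f i * g (n ∸ i))                  ≡⟨ ∑-reverse n (λ i → f i * g (n ∸ i)) ⟩
  ∑ (suc n) (λ i → f (n ∸ i) * g (n ∸ (n ∸ i)))      ≡⟨ ∑-cong< (suc n) (λ i i≤n → swap n i (ℕₚ.≤-pred i≤n)) ⟩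
  ∑ (suc n) (λ i → g i * f (n ∸ i))                  ≡⟨ ⊗-∑ g f n ⟨
  (g ⊗ f) n                                          ∎
  where
  swap : ∀ n i → i ℕ.≤ n → f (n ∸ i) * g (n ∸ (n ∸ i)) ≡ g i * f (n ∸ i)
  swap n i i≤n = trans (ℚₚ.*-comm (f (n ∸ i)) _) (cong (λ k → g k * f (n ∸ i)) (ℕₚ.m∸[m∸n]≡n i≤n))

⊗-assoc : ∀ f g h → (f ⊗ g) ⊗ h ≈ f ⊗ (g ⊗ h)
⊗-assoc f g h = mk≈ λ n → begin
  ((f ⊗ g) ⊗ h) n
    ≡⟨ ⊗-∑ (f ⊗ g) h n ⟩
  ∑ (suc n) (λ k → (f ⊗ g) k * h (n ∸ k))
    ≡⟨ ∑-cong (suc n) (λ k → trans (cong (_* h (n ∸ k)) (⊗-∑ f g k)) (sym (∑-*ʳ (suc k) (h (n ∸ k)) (λ i → f i * g (k ∸ i))))) ⟩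
  ∑ (suc n) (λ k → ∑ (suc k) (λ i → f i * g (k ∸ i) * h (n ∸ k)))
    ≡⟨ ∑-cong< (suc n) (λ k k≤n → ∑-cong< (suc k) (λ i i≤k → reassociate n k i (ℕₚ.≤-pred i≤k))) ⟩
  ∑ (suc n) (λ k → ∑ (suc k) (λ i → f i * (g (k ∸ i) * h (n ∸ i ∸ (k ∸ i)))))
    ≡⟨ ∑-triangle n (λ i j → f i * (g j * h (n ∸ i ∸ j))) ⟨
  ∑ (suc n) (λ i → ∑ (suc (n ∸ i)) (λ j → f i * (g j * h (n ∸ i ∸ j))))
    ≡⟨ ∑-cong (suc n) (λ i → trans (∑-*ˡ (suc (n ∸ i)) (f i) (λ j → g j * h (n ∸ i ∸ j))) (cong (f i *_) (sym (⊗-∑ g h (n ∸ i))))) ⟩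
  ∑ (suc n) (λ i → f i * (g ⊗ h) (n ∸ i))
    ≡⟨ ⊗-∑ f (g ⊗ h) n ⟨
  (f ⊗ (g ⊗ h)) n  ∎
  where
  reassociate : ∀ n k i → i ℕ.≤ k → f i * g (k ∸ i) * h (n ∸ k) ≡ f i * (g (k ∸ i) * h (n ∸ i ∸ (k ∸ i)))
  reassociate n k i i≤k = trans (ℚₚ.*-assoc (f i) _ _)
    (cong (λ m → f i * (g (k ∸ i) * h m)) (sym (trans (ℕₚ.∸-+-assoc n i (k ∸ i)) (cong (n ∸_) (ℕₚ.m+[n∸m]≡n i≤k)))))

⊗-constantˡ : ∀ c f → constant c ⊗ f ≈ c · f
⊗-constantˡ c f = mk≈ λ n → begin
  (constant c ⊗ f) n                        ≡⟨ ⊗-∑ (constant c) f n ⟩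
  c * f n + ∑ n (λ i → 0ℚ * f (n ∸ suc i))  ≡⟨ cong (_+_ (c * f n)) (∑-zero n _ (λ i _ → ℚₚ.*-zeroˡ (f (n ∸ suc i)))) ⟩
  c * f n + 0ℚ                              ≡⟨ ℚₚ.+-identityʳ (c * f n) ⟩
  c * f n                                   ∎

⊗-distribˡ-⊕ : ∀ f g h → f ⊗ (g ⊕ h) ≈ f ⊗ g ⊕ f ⊗ h
⊗-distribˡ-⊕ f g h = mk≈ λ n → begin
  (f ⊗ (g ⊕ h)) n
    ≡⟨ ⊗-∑ f (g ⊕ h) n ⟩
  ∑ (suc n) (λ i → f i * (g (n ∸ i) + h (n ∸ i)))
    ≡⟨ ∑-cong (suc n) (λ i → ℚₚ.*-distribˡ-+ (f i) (g (n ∸ i)) (h (n ∸ i))) ⟩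
  ∑ (suc n) (λ i → f i * g (n ∸ i) + f i * h (n ∸ i))
    ≡⟨ ∑-+ (suc n) (λ i → f i * g (n ∸ i)) (λ i → f i * h (n ∸ i)) ⟩
  ∑ (suc n) (λ i → f i * g (n ∸ i)) + ∑ (suc n) (λ i → f i * h (n ∸ i))
    ≡⟨ cong₂ _+_ (⊗-∑ f g n) (⊗-∑ f h n) ⟨
  (f ⊗ g ⊕ f ⊗ h) n  ∎

series-isCommutativeRing : IsCommutativeRing _≈_ _⊕_ _⊗_ neg (constant 0ℚ) (constant 1ℚ)
series-isCommutativeRing = record
  { isRing = record
    { +-isAbelianGroup = record
      { isGroup = record
        { isMonoid = record
          { isSemigroup = record
            { isMagma = record
              { isEquivalence = record { refl = ≈-refl ; sym = ≈-sym ; trans = ≈-trans }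
              ; ∙-cong = ⊕-cong }
            ; assoc = λ f g h → mk≈ λ n → ℚₚ.+-assoc (f n) (g n) (h n) }
          ; identity = (λ f → mk≈ λ n → trans (cong (_+ f n) (constant-0 n)) (ℚₚ.+-identityˡ (f n)))
                     , (λ f → mk≈ λ n → trans (cong (_+_ (f n)) (constant-0 n)) (ℚₚ.+-identityʳ (f n))) }
        ; inverse = (λ f → mk≈ λ n → trans (ℚₚ.+-inverseˡ (f n)) (sym (constant-0 n)))
                  , (λ f → mk≈ λ n → trans (ℚₚ.+-inverseʳ (f n)) (sym (constant-0 n)))
        ; ⁻¹-cong = neg-cong }
      ; comm = λ f g → mk≈ λ n → ℚₚ.+-comm (f n) (g n) }
    ; *-cong = ⊗-cong
    ; *-assoc = ⊗-assoc
    ; *-identity = ⊗-identityˡ , λ f → ≈-trans (⊗-comm f (constant 1ℚ)) (⊗-identityˡ f)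
    ; distrib = ⊗-distribˡ-⊕
              , λ h f g → ≈-trans (⊗-comm (f ⊕ g) h)
                            (≈-trans (⊗-distribˡ-⊕ h f g) (⊕-cong (⊗-comm h f) (⊗-comm h g))) }
  ; *-comm = ⊗-comm }
  where
  constant-0 : ∀ n → constant 0ℚ n ≡ 0ℚ
  constant-0 zero    = refl
  constant-0 (suc n) = refl
  ⊗-identityˡ : ∀ f → constant 1ℚ ⊗ f ≈ f
  ⊗-identityˡ f = ≈-trans (⊗-constantˡ 1ℚ f) (mk≈ λ n → ℚₚ.*-identityˡ (f n))

series-commutativeRing : CommutativeRing 0ℓ 0ℓ
series-commutativeRing = record { isCommutativeRing = series-isCommutativeRing }

module SeriesSolver where
  open import Algebra.Solver.Ring.AlmostCommutativeRing using (fromCommutativeRing; _-Raw-AlmostCommutative⟶_)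

  constant-morphism : +-*-rawRing -Raw-AlmostCommutative⟶ fromCommutativeRing series-commutativeRing
  constant-morphism = record
    { ⟦_⟧    = constant
    ; +-homo = λ a b → mk≈ λ { zero → refl ; (suc n) → sym (ℚₚ.+-identityˡ 0ℚ) }
    ; *-homo = λ a b → ≈-trans (mk≈ λ { zero → refl ; (suc n) → sym (ℚₚ.*-zeroʳ a) }) (≈-sym (⊗-constantˡ a (constant b)))
    ; -‿homo = λ a → mk≈ λ { zero → refl ; (suc n) → refl }
    ; 0-homo = ≈-refl
    ; 1-homo = ≈-refl }

  constant-≟ : ∀ a b → Maybe (constant a ≈ constant b)
  constant-≟ a b with a ℚₚ.≟ b
  ... | yes refl = just ≈-refl
  ... | no _     = nothing

  open import Algebra.Solver.Ring +-*-rawRing (fromCommutativeRing series-commutativeRing)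
    constant-morphism constant-≟ public

D-⊕ : ∀ f g → D (f ⊕ g) ≈ D f ⊕ D g
D-⊕ f g = mk≈ λ n → ℚₚ.*-distribˡ-+ ⟦ n ⟧ (f n) (g n)

D-⊖ : ∀ f g → D (f ⊖ g) ≈ D f ⊖ D g
D-⊖ f g = mk≈ λ n → trans (ℚₚ.*-distribˡ-+ ⟦ n ⟧ (f n) (- g n)) (cong (_+_ (⟦ n ⟧ * f n)) (sym (ℚₚ.neg-distribʳ-* ⟦ n ⟧ (g n))))

D-· : ∀ c f → D (c · f) ≈ c · D f
D-· c f = mk≈ λ n → x∙yz≈y∙xz ⟦ n ⟧ c (f n)

D-⊗ : ∀ f g → D (f ⊗ g) ≈ D f ⊗ g ⊕ f ⊗ D g
D-⊗ f g = mk≈ λ n → begin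
  ⟦ n ⟧ * (f ⊗ g) n
    ≡⟨ cong (⟦ n ⟧ *_) (⊗-∑ f g n) ⟩
  ⟦ n ⟧ * ∑ (suc n) (λ i → f i * g (n ∸ i))
    ≡⟨ ∑-*ˡ (suc n) ⟦ n ⟧ (λ i → f i * g (n ∸ i)) ⟨
  ∑ (suc n) (λ i → ⟦ n ⟧ * (f i * g (n ∸ i)))
    ≡⟨ ∑-cong< (suc n) (λ i i≤n → leibniz n i (ℕₚ.≤-pred i≤n)) ⟩
  ∑ (suc n) (λ i → ⟦ i ⟧ * f i * g (n ∸ i) + f i * (⟦ n ∸ i ⟧ * g (n ∸ i)))
    ≡⟨ ∑-+ (suc n) (λ i → ⟦ i ⟧ * f i * g (n ∸ i)) (λ i → f i * (⟦ n ∸ i ⟧ * g (n ∸ i))) ⟩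
  ∑ (suc n) (λ i → ⟦ i ⟧ * f i * g (n ∸ i)) + ∑ (suc n) (λ i → f i * (⟦ n ∸ i ⟧ * g (n ∸ i)))
    ≡⟨ cong₂ _+_ (⊗-∑ (D f) g n) (⊗-∑ f (D g) n) ⟨
  (D f ⊗ g ⊕ f ⊗ D g) n  ∎
  where
  leibniz : ∀ n i → i ℕ.≤ n →
            ⟦ n ⟧ * (f i * g (n ∸ i)) ≡ ⟦ i ⟧ * f i * g (n ∸ i) + f i * (⟦ n ∸ i ⟧ * g (n ∸ i))
  leibniz n i i≤n = begin
    ⟦ n ⟧ * (f i * g (n ∸ i))
      ≡⟨ cong (λ m → ⟦ m ⟧ * (f i * g (n ∸ i))) (ℕₚ.m+[n∸m]≡n i≤n) ⟨
    ⟦ i ℕ.+ (n ∸ i) ⟧ * (f i * g (n ∸ i))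
      ≡⟨ cong (_* (f i * g (n ∸ i))) (⟦⟧-+ i (n ∸ i)) ⟩
    (⟦ i ⟧ + ⟦ n ∸ i ⟧) * (f i * g (n ∸ i))
      ≡⟨ solve 4 (λ a b x y → (a :+ b) :* (x :* y) := a :* x :* y :+ x :* (b :* y)) refl ⟦ i ⟧ ⟦ n ∸ i ⟧ (f i) (g (n ∸ i)) ⟩
    ⟦ i ⟧ * f i * g (n ∸ i) + f i * (⟦ n ∸ i ⟧ * g (n ∸ i))  ∎

infixr 8 _∙_
infixl 7 _⊠_
infixl 6 _⊞_ _⊟_

data Expr : Set where
  e₂ e₄ e₆    : Expr
  _∙_         : ℚ → Expr → Expr
  _⊠_ _⊞_ _⊟_ : Expr → Expr → Expr

eval : Expr → Series
eval e₂      = E₂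
eval e₄      = E₄
eval e₆      = E₆
eval (c ∙ t) = c · eval t
eval (t ⊠ u) = eval t ⊗ eval u
eval (t ⊞ u) = eval t ⊕ eval u
eval (t ⊟ u) = eval t ⊖ eval u

∂ : Expr → Expr
∂ e₂      = (+ 1 / 12) ∙ (e₂ ⊠ e₂ ⊟ e₄)
∂ e₄      = (+ 1 / 3) ∙ (e₂ ⊠ e₄ ⊟ e₆)
∂ e₆      = ½ ∙ (e₂ ⊠ e₆ ⊟ e₄ ⊠ e₄)
∂ (c ∙ t) = c ∙ ∂ t
∂ (t ⊠ u) = ∂ t ⊠ u ⊞ t ⊠ ∂ u
∂ (t ⊞ u) = ∂ t ⊞ ∂ u
∂ (t ⊟ u) = ∂ t ⊟ ∂ u

RamanujanEquations : Set
RamanujanEquations = D E₂ ≈ eval (∂ e₂) × D E₄ ≈ eval (∂ e₄) × D E₆ ≈ eval (∂ e₆)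

D-eval : RamanujanEquations → ∀ t → D (eval t) ≈ eval (∂ t)
D-eval (ram₂ , ram₄ , ram₆) = go
  where
  go : ∀ t → D (eval t) ≈ eval (∂ t)
  go e₂      = ram₂
  go e₄      = ram₄
  go e₆      = ram₆
  go (c ∙ t) = ≈-trans (D-· c (eval t)) (·-cong {c} (go t))
  go (t ⊠ u) = ≈-trans (D-⊗ (eval t) (eval u)) (⊕-cong (⊗-cong (go t) ≈-refl) (⊗-cong (≈-refl {eval t}) (go u)))
  go (t ⊞ u) = ≈-trans (D-⊕ (eval t) (eval u)) (⊕-cong (go t) (go u))
  go (t ⊟ u) = ≈-trans (D-⊖ (eval t) (eval u)) (⊖-cong (go t) (go u))

toPolynomial : Expr → SeriesSolver.Polynomial 3
toPolynomial e₂      = SeriesSolver.var Fin.zero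
toPolynomial e₄      = SeriesSolver.var (Fin.suc Fin.zero)
toPolynomial e₆      = SeriesSolver.var (Fin.suc (Fin.suc Fin.zero))
toPolynomial (c ∙ t) = SeriesSolver.con c SeriesSolver.:* toPolynomial t
toPolynomial (t ⊠ u) = toPolynomial t SeriesSolver.:* toPolynomial u
toPolynomial (t ⊞ u) = toPolynomial t SeriesSolver.:+ toPolynomial u
toPolynomial (t ⊟ u) = toPolynomial t SeriesSolver.:- toPolynomial u

Eisenstein : Vec Series 3
Eisenstein = E₂ ∷ E₄ ∷ E₆ ∷ []

eval-toPolynomial : ∀ t → eval t ≈ SeriesSolver.⟦ toPolynomial t ⟧ Eisenstein
eval-toPolynomial e₂      = ≈-refl
eval-toPolynomial e₄      = ≈-refl
eval-toPolynomial e₆      = ≈-refl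
eval-toPolynomial (c ∙ t) = ≈-trans (·-cong {c} (eval-toPolynomial t)) (≈-sym (⊗-constantˡ c _))
eval-toPolynomial (t ⊠ u) = ⊗-cong (eval-toPolynomial t) (eval-toPolynomial u)
eval-toPolynomial (t ⊞ u) = ⊕-cong (eval-toPolynomial t) (eval-toPolynomial u)
eval-toPolynomial (t ⊟ u) = ⊖-cong (eval-toPolynomial t) (eval-toPolynomial u)

-- The hypothesis holds by ≈-refl as soon as t and u are equal as polynomials.
eval-≈ : ∀ t u → SeriesSolver.⟦ toPolynomial t ⟧↓ Eisenstein ≈ SeriesSolver.⟦ toPolynomial u ⟧↓ Eisenstein →
         eval t ≈ eval u
eval-≈ t u nf = ≈-trans (eval-toPolynomial t)
  (≈-trans (SeriesSolver.prove Eisenstein (toPolynomial t) (toPolynomial u) nf) (≈-sym (eval-toPolynomial u)))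

-- Liouville's method

Fun⁴ : Set
Fun⁴ = ℕ → ℕ → ℕ → ℕ → ℚ

∑⁴ : ℕ → Fun⁴ → ℚ
∑⁴ N F = ∑₁ N λ a → ∑₁ N λ b → ∑₁ N λ x → ∑₁ N λ y → F a b x y

∑⁴-cong : ∀ N {F G : Fun⁴} → (∀ a b x y → F a b x y ≡ G a b x y) → ∑⁴ N F ≡ ∑⁴ N G
∑⁴-cong N F≗G = ∑-cong N λ a → ∑-cong N λ b → ∑-cong N λ x → ∑-cong N λ y → F≗G (suc a) (suc b) (suc x) (suc y)

∑⁴-+ : ∀ N (F G : Fun⁴) → ∑⁴ N (λ a b x y → F a b x y + G a b x y) ≡ ∑⁴ N F + ∑⁴ N G
∑⁴-+ N F G =
  trans (∑-cong N λ a →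
          trans (∑-cong N λ b →
                  trans (∑-cong N λ x → ∑₁-+ N (F (suc a) (suc b) (suc x)) (G (suc a) (suc b) (suc x)))
                        (∑₁-+ N (λ x → ∑₁ N (F (suc a) (suc b) x)) (λ x → ∑₁ N (G (suc a) (suc b) x))))
                (∑₁-+ N (λ b → ∑₁ N λ x → ∑₁ N (F (suc a) b x)) (λ b → ∑₁ N λ x → ∑₁ N (G (suc a) b x))))
        (∑₁-+ N (λ a → ∑₁ N λ b → ∑₁ N λ x → ∑₁ N (F a b x)) (λ a → ∑₁ N λ b → ∑₁ N λ x → ∑₁ N (G a b x)))

∑⁴-swap₁₂ : ∀ N (F : Fun⁴) → ∑⁴ N F ≡ ∑⁴ N (λ a b x y → F b a x y)
∑⁴-swap₁₂ N F = ∑₁-swap N N (λ a b → ∑₁ N λ x → ∑₁ N λ y → F a b x y)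

∑⁴-swap₂₃ : ∀ N (F : Fun⁴) → ∑⁴ N F ≡ ∑⁴ N (λ a b x y → F a x b y)
∑⁴-swap₂₃ N F = ∑-cong N λ a → ∑₁-swap N N (λ b x → ∑₁ N λ y → F (suc a) b x y)

∑⁴-swap₃₄ : ∀ N (F : Fun⁴) → ∑⁴ N F ≡ ∑⁴ N (λ a b x y → F a b y x)
∑⁴-swap₃₄ N F = ∑-cong N λ a → ∑-cong N λ b → ∑₁-swap N N (λ x y → F (suc a) (suc b) x y)

Weight : Set
Weight = ℕ → ℕ → ℕ → ℕ → ℕ

infix 8 ∑⁴[_≡_]_
∑⁴[_≡_]_ : Weight → ℕ → Fun⁴ → ℚ
∑⁴[ w ≡ n ] f = ∑⁴ n (λ a b x y → δ (w a b x y) n * f a b x y)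

∑⁴[]-cong : ∀ w n {f g : Fun⁴} → (∀ a b x y → f a b x y ≡ g a b x y) → ∑⁴[ w ≡ n ] f ≡ ∑⁴[ w ≡ n ] g
∑⁴[]-cong w n f≗g = ∑⁴-cong n (λ a b x y → cong (δ (w a b x y) n *_) (f≗g a b x y))

∑⁴[]-+ : ∀ w n (f g : Fun⁴) → ∑⁴[ w ≡ n ] (λ a b x y → f a b x y + g a b x y) ≡ ∑⁴[ w ≡ n ] f + ∑⁴[ w ≡ n ] g
∑⁴[]-+ w n f g = trans (∑⁴-cong n (λ a b x y → ℚₚ.*-distribˡ-+ (δ (w a b x y) n) (f a b x y) (g a b x y)))
                       (∑⁴-+ n (λ a b x y → δ (w a b x y) n * f a b x y) (λ a b x y → δ (w a b x y) n * g a b x y))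

∑⁴[]-*ˡ : ∀ w n c (f : Fun⁴) → ∑⁴[ w ≡ n ] (λ a b x y → c * f a b x y) ≡ c * ∑⁴[ w ≡ n ] f
∑⁴[]-*ˡ w n c f =
  trans (∑⁴-cong n λ a b x y → x∙yz≈y∙xz (δ (w a b x y) n) c (f a b x y))
        (trans (∑-cong n λ a →
                 trans (∑-cong n λ b →
                         trans (∑-cong n λ x → ∑₁-*ˡ n c (g (suc a) (suc b) (suc x)))
                               (∑₁-*ˡ n c (λ x → ∑₁ n (g (suc a) (suc b) x))))
                       (∑₁-*ˡ n c (λ b → ∑₁ n λ x → ∑₁ n (g (suc a) b x))))
               (∑₁-*ˡ n c (λ a → ∑₁ n λ b → ∑₁ n λ x → ∑₁ n (g a b x))))
  where
  g : Fun⁴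
  g a b x y = δ (w a b x y) n * f a b x y

ax+by ax+bx+by : Weight
ax+by    a b x y = a ℕ.* x ℕ.+ b ℕ.* y
ax+bx+by a b x y = (a ℕ.+ b) ℕ.* x ℕ.+ b ℕ.* y

∑⁴[ax+by]-swap-pairs : ∀ n (f : Fun⁴) → ∑⁴[ ax+by ≡ n ] f ≡ ∑⁴[ ax+by ≡ n ] (λ a b x y → f b a y x)
∑⁴[ax+by]-swap-pairs n f =
  trans (∑⁴-swap₁₂ n g) (trans (∑⁴-swap₃₄ n (λ a b x y → g b a x y))
        (∑⁴-cong n λ a b x y → cong (λ k → δ k n * f b a y x) (ℕₚ.+-comm (b ℕ.* y) (a ℕ.* x))))
  where
  g : Fun⁴
  g a b x y = δ (ax+by a b x y) n * f a b x y

∑⁴[ax+by]-swap-blocks : ∀ n (f : Fun⁴) → ∑⁴[ ax+by ≡ n ] f ≡ ∑⁴[ ax+by ≡ n ] (λ a b x y → f x y a b)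
∑⁴[ax+by]-swap-blocks n f =
  trans (∑⁴-swap₂₃ n g) (trans (∑⁴-swap₁₂ n (λ a b x y → g a x b y))
        (trans (∑⁴-swap₃₄ n (λ a b x y → g b x a y)) (trans (∑⁴-swap₂₃ n (λ a b x y → g b y a x))
        (∑⁴-cong n λ a b x y → cong (λ k → δ k n * f x y a b) (cong₂ ℕ._+_ (ℕₚ.*-comm x a) (ℕₚ.*-comm y b))))))
  where
  g : Fun⁴
  g a b x y = δ (ax+by a b x y) n * f a b x y

∑⁴[ax+bx+by]-reverse : ∀ n (f : Fun⁴) → ∑⁴[ ax+bx+by ≡ n ] f ≡ ∑⁴[ ax+bx+by ≡ n ] (λ a b x y → f y x b a)
∑⁴[ax+bx+by]-reverse n f =
  trans (∑⁴-swap₁₂ n g) (trans (∑⁴-swap₂₃ n (λ a b x y → g b a x y))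
        (trans (∑⁴-swap₁₂ n (λ a b x y → g x a b y)) (trans (∑⁴-swap₃₄ n (λ a b x y → g x b a y))
        (trans (∑⁴-swap₂₃ n (λ a b x y → g y b a x)) (trans (∑⁴-swap₁₂ n (λ a b x y → g y x a b))
        (∑⁴-cong n λ a b x y → cong (λ k → δ k n * f y x b a) (weight a b x y)))))))
  where
  g : Fun⁴
  g a b x y = δ (ax+bx+by a b x y) n * f a b x y
  weight : ∀ a b x y → (y ℕ.+ x) ℕ.* b ℕ.+ x ℕ.* a ≡ (a ℕ.+ b) ℕ.* x ℕ.+ b ℕ.* y
  weight = ℕ-solve 4 (λ a b x y → (y ℕ:+ x) ℕ:* b ℕ:+ x ℕ:* a ℕ:= (a ℕ:+ b) ℕ:* x ℕ:+ b ℕ:* y) refl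

infix 8 ∑³[_≡_]_
∑³[_≡_]_ : (ℕ → ℕ → ℕ → ℕ) → ℕ → (ℕ → ℕ → ℕ → ℚ) → ℚ
∑³[ w ≡ n ] h = ∑₁ n λ a → ∑₁ n λ x → ∑₁ n λ y → δ (w a x y) n * h a x y

ax+ay : ℕ → ℕ → ℕ → ℕ
ax+ay a x y = a ℕ.* (x ℕ.+ y)

m≤m*n⁺ : ∀ m {n} → 1 ℕ.≤ n → m ℕ.≤ m ℕ.* n
m≤m*n⁺ m {n} 1≤n = ℕₚ.≤-trans (ℕₚ.≤-reflexive (sym (ℕₚ.*-identityʳ m))) (ℕₚ.*-monoʳ-≤ m 1≤n)

private
  ∑ˣʸ : ℕ → Fun⁴ → ℕ → ℕ → ℚ
  ∑ˣʸ n f a b = ∑₁ n λ x → ∑₁ n λ y → δ (ax+by a b x y) n * f a b x y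

  ∑ˣʸ-vanishes : ∀ n f a b → n ℕ.< a ⊎ n ℕ.< b → ∑ˣʸ n f a b ≡ 0ℚ
  ∑ˣʸ-vanishes n f a b n<a⊎n<b = ∑₁-zero n _ λ x 1≤x _ →
    ∑₁-zero n (λ y → δ (ax+by a b x y) n * f a b x y) λ y 1≤y _ → δ*-≢ (f a b x y) (too-big n<a⊎n<b x y 1≤x 1≤y)
    where
    too-big : n ℕ.< a ⊎ n ℕ.< b → ∀ x y → 1 ℕ.≤ x → 1 ℕ.≤ y → ax+by a b x y ≢ n
    too-big (inj₁ n<a) x y 1≤x _ refl =
      ℕₚ.<⇒≱ n<a (ℕₚ.≤-trans (m≤m*n⁺ a 1≤x) (ℕₚ.m≤m+n (a ℕ.* x) (b ℕ.* y)))
    too-big (inj₂ n<b) x y _ 1≤y refl =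
      ℕₚ.<⇒≱ n<b (ℕₚ.≤-trans (m≤m*n⁺ b 1≤y) (ℕₚ.m≤n+m (b ℕ.* y) (a ℕ.* x)))

-- Splitting according to b < a, b = a, b > a and substituting a ↦ a + b, resp. b ↦ a + b.
∑⁴[ax+by]-split : ∀ n (f : Fun⁴) →
  ∑⁴[ ax+by ≡ n ] f ≡ ∑⁴[ ax+bx+by ≡ n ] (λ a b x y → f (a ℕ.+ b) b x y)
                    + ∑³[ ax+ay ≡ n ] (λ a x y → f a a x y)
                    + ∑⁴[ ax+bx+by ≡ n ] (λ a b x y → f b (a ℕ.+ b) y x)
∑⁴[ax+by]-split n f = begin
  ∑₁ n (λ a → ∑₁ n (∑ˣʸ n f a))
    ≡⟨ ∑₁-cong n (λ a 1≤a a≤n → trichotomy a 1≤a a≤n) ⟩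
  ∑₁ n (λ a → ∑₁ n (λ b → δ< b a * ∑ˣʸ n f a b) + ∑ˣʸ n f a a + ∑₁ n (λ b → ∑ˣʸ n f a (a ℕ.+ b)))
    ≡⟨ ∑₁-+ n (λ a → ∑₁ n (λ b → δ< b a * ∑ˣʸ n f a b) + ∑ˣʸ n f a a) (λ a → ∑₁ n (λ b → ∑ˣʸ n f a (a ℕ.+ b))) ⟩
  ∑₁ n (λ a → ∑₁ n (λ b → δ< b a * ∑ˣʸ n f a b) + ∑ˣʸ n f a a) + ∑₁ n (λ a → ∑₁ n (λ b → ∑ˣʸ n f a (a ℕ.+ b)))
    ≡⟨ cong (_+ ∑₁ n (λ a → ∑₁ n (λ b → ∑ˣʸ n f a (a ℕ.+ b))))
            (∑₁-+ n (λ a → ∑₁ n (λ b → δ< b a * ∑ˣʸ n f a b)) (λ a → ∑ˣʸ n f a a)) ⟩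
  ∑₁ n (λ a → ∑₁ n (λ b → δ< b a * ∑ˣʸ n f a b)) + ∑₁ n (λ a → ∑ˣʸ n f a a) + ∑₁ n (λ a → ∑₁ n (λ b → ∑ˣʸ n f a (a ℕ.+ b)))
    ≡⟨ cong₂ _+_ (cong₂ _+_ b<a b≡a) b>a ⟩
  ∑⁴[ ax+bx+by ≡ n ] (λ a b x y → f (a ℕ.+ b) b x y) + ∑³[ ax+ay ≡ n ] (λ a x y → f a a x y)
    + ∑⁴[ ax+bx+by ≡ n ] (λ a b x y → f b (a ℕ.+ b) y x)  ∎
  where
  trichotomy : ∀ a → 1 ℕ.≤ a → a ℕ.≤ n →
               ∑₁ n (∑ˣʸ n f a) ≡ ∑₁ n (λ b → δ< b a * ∑ˣʸ n f a b) + ∑ˣʸ n f a a + ∑₁ n (λ b → ∑ˣʸ n f a (a ℕ.+ b))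
  trichotomy a 1≤a a≤n = trans (∑₁-trichotomy n a (∑ˣʸ n f a))
    (cong₂ _+_ (cong (_+_ (∑₁ n (λ b → δ< b a * ∑ˣʸ n f a b))) (∑₁-δ n a (∑ˣʸ n f a) 1≤a a≤n))
               (∑₁-δ< n a (∑ˣʸ n f a) (λ b n<b → ∑ˣʸ-vanishes n f a b (inj₂ n<b))))
  b<a : ∑₁ n (λ a → ∑₁ n (λ b → δ< b a * ∑ˣʸ n f a b)) ≡ ∑⁴[ ax+bx+by ≡ n ] (λ a b x y → f (a ℕ.+ b) b x y)
  b<a = begin
    ∑₁ n (λ a → ∑₁ n (λ b → δ< b a * ∑ˣʸ n f a b))
      ≡⟨ ∑₁-swap n n (λ a b → δ< b a * ∑ˣʸ n f a b) ⟩
    ∑₁ n (λ b → ∑₁ n (λ a → δ< b a * ∑ˣʸ n f a b))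
      ≡⟨ ∑-cong n (λ b → ∑₁-δ< n (suc b) (λ a → ∑ˣʸ n f a (suc b)) (λ a n<a → ∑ˣʸ-vanishes n f a (suc b) (inj₁ n<a))) ⟩
    ∑⁴ n (λ b a x y → δ ((b ℕ.+ a) ℕ.* x ℕ.+ b ℕ.* y) n * f (b ℕ.+ a) b x y)
      ≡⟨ ∑⁴-cong n (λ b a x y → cong (λ c → δ (c ℕ.* x ℕ.+ b ℕ.* y) n * f c b x y) (ℕₚ.+-comm b a)) ⟩
    ∑⁴ n (λ b a x y → δ (ax+bx+by a b x y) n * f (a ℕ.+ b) b x y)
      ≡⟨ ∑⁴-swap₁₂ n (λ a b x y → δ (ax+bx+by a b x y) n * f (a ℕ.+ b) b x y) ⟨
    ∑⁴[ ax+bx+by ≡ n ] (λ a b x y → f (a ℕ.+ b) b x y)  ∎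
  b≡a : ∑₁ n (λ a → ∑ˣʸ n f a a) ≡ ∑³[ ax+ay ≡ n ] (λ a x y → f a a x y)
  b≡a = ∑-cong n λ a → ∑-cong n λ x → ∑-cong n λ y →
          cong (λ k → δ k n * f (suc a) (suc a) (suc x) (suc y)) (sym (ℕₚ.*-distribˡ-+ (suc a) (suc x) (suc y)))
  b>a : ∑₁ n (λ a → ∑₁ n (λ b → ∑ˣʸ n f a (a ℕ.+ b))) ≡ ∑⁴[ ax+bx+by ≡ n ] (λ a b x y → f b (a ℕ.+ b) y x)
  b>a = begin
    ∑⁴ n (λ a b x y → δ (a ℕ.* x ℕ.+ (a ℕ.+ b) ℕ.* y) n * f a (a ℕ.+ b) x y)
      ≡⟨ ∑⁴-cong n (λ a b x y → cong₂ (λ k c → δ k n * f a c x y) (weight a b x y) (ℕₚ.+-comm a b)) ⟩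
    ∑⁴ n (λ a b x y → δ ((b ℕ.+ a) ℕ.* y ℕ.+ a ℕ.* x) n * f a (b ℕ.+ a) x y)
      ≡⟨ ∑⁴-swap₃₄ n (λ a b x y → δ ((b ℕ.+ a) ℕ.* x ℕ.+ a ℕ.* y) n * f a (b ℕ.+ a) y x) ⟨
    ∑⁴ n (λ a b x y → δ ((b ℕ.+ a) ℕ.* x ℕ.+ a ℕ.* y) n * f a (b ℕ.+ a) y x)
      ≡⟨ ∑⁴-swap₁₂ n (λ a b x y → δ (ax+bx+by a b x y) n * f b (a ℕ.+ b) y x) ⟨
    ∑⁴[ ax+bx+by ≡ n ] (λ a b x y → f b (a ℕ.+ b) y x)  ∎
    where
    weight : ∀ a b x y → a ℕ.* x ℕ.+ (a ℕ.+ b) ℕ.* y ≡ (b ℕ.+ a) ℕ.* y ℕ.+ a ℕ.* x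
    weight = ℕ-solve 4 (λ a b x y → a ℕ:* x ℕ:+ (a ℕ:+ b) ℕ:* y ℕ:= (b ℕ:+ a) ℕ:* y ℕ:+ a ℕ:* x) refl

∑⁴[ax+bx+by]-antisymmetric : ∀ n (F : Fun⁴) → (∀ a b x y → F a b x y + F y x b a ≡ 0ℚ) →
                             ∑⁴[ ax+bx+by ≡ n ] F ≡ 0ℚ
∑⁴[ax+bx+by]-antisymmetric n F anti = begin
  P F                                         ≡⟨ solve 1 (λ s → s := con ½ :* (s :+ s)) refl (P F) ⟩
  ½ * (P F + P F)                             ≡⟨ cong (λ s → ½ * (P F + s)) (∑⁴[ax+bx+by]-reverse n F) ⟩
  ½ * (P F + P (λ a b x y → F y x b a))       ≡⟨ cong (½ *_) (∑⁴[]-+ ax+bx+by n F (λ a b x y → F y x b a)) ⟨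
  ½ * P (λ a b x y → F a b x y + F y x b a)   ≡⟨ cong (½ *_) (∑⁴[]-cong ax+bx+by n anti) ⟩
  ½ * P (λ _ _ _ _ → 0ℚ)                      ≡⟨ cong (½ *_) (∑⁴[]-*ˡ ax+bx+by n 0ℚ (λ _ _ _ _ → 0ℚ)) ⟩
  ½ * (0ℚ * P (λ _ _ _ _ → 0ℚ))               ≡⟨ solve 1 (λ s → con ½ :* (con 0ℚ :* s) := con 0ℚ) refl (P (λ _ _ _ _ → 0ℚ)) ⟩
  0ℚ                                          ∎
  where
  P : Fun⁴ → ℚ
  P h = ∑⁴[ ax+bx+by ≡ n ] h

liouville : ∀ n (f : Fun⁴) →
  (∀ a b x y → f (a ℕ.+ b) b x y + f b (a ℕ.+ b) y x + (f (y ℕ.+ x) x b a + f x (y ℕ.+ x) a b) ≡ 0ℚ) →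
  ∑⁴[ ax+by ≡ n ] f ≡ ∑³[ ax+ay ≡ n ] (λ a x y → f a a x y)
liouville n f balanced = begin
  ∑⁴[ ax+by ≡ n ] f
    ≡⟨ ∑⁴[ax+by]-split n f ⟩
  ∑⁴[ ax+bx+by ≡ n ] f₁ + K + ∑⁴[ ax+bx+by ≡ n ] f₂
    ≡⟨ solve 3 (λ p k r → p :+ k :+ r := p :+ r :+ k) refl (∑⁴[ ax+bx+by ≡ n ] f₁) K (∑⁴[ ax+bx+by ≡ n ] f₂) ⟩
  ∑⁴[ ax+bx+by ≡ n ] f₁ + ∑⁴[ ax+bx+by ≡ n ] f₂ + K
    ≡⟨ cong (_+ K) (∑⁴[]-+ ax+bx+by n f₁ f₂) ⟨
  ∑⁴[ ax+bx+by ≡ n ] (λ a b x y → f₁ a b x y + f₂ a b x y) + K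
    ≡⟨ cong (_+ K) (∑⁴[ax+bx+by]-antisymmetric n (λ a b x y → f₁ a b x y + f₂ a b x y) balanced) ⟩
  0ℚ + K
    ≡⟨ ℚₚ.+-identityˡ K ⟩
  K ∎
  where
  f₁ f₂ : Fun⁴
  f₁ a b x y = f (a ℕ.+ b) b x y
  f₂ a b x y = f b (a ℕ.+ b) y x
  K : ℚ
  K = ∑³[ ax+ay ≡ n ] (λ a x y → f a a x y)

infix 8 ∑²[_≡_]_
∑²[_≡_]_ : (ℕ → ℕ → ℕ) → ℕ → (ℕ → ℕ → ℚ) → ℚ
∑²[ w ≡ n ] F = ∑₁ n λ d → ∑₁ n λ m → δ (w d m) n * F d m

∑²[]-cong : ∀ w n {F G : ℕ → ℕ → ℚ} → (∀ d m → F (suc d) (suc m) ≡ G (suc d) (suc m)) → ∑²[ w ≡ n ] F ≡ ∑²[ w ≡ n ] G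
∑²[]-cong w n F≗G = ∑-cong n λ d → ∑-cong n λ m → cong (δ (w (suc d) (suc m)) n *_) (F≗G d m)

∑²[]-+ : ∀ w n (F G : ℕ → ℕ → ℚ) → ∑²[ w ≡ n ] (λ d m → F d m + G d m) ≡ ∑²[ w ≡ n ] F + ∑²[ w ≡ n ] G
∑²[]-+ w n F G = trans
  (∑-cong n λ d → trans (∑-cong n λ m → ℚₚ.*-distribˡ-+ (δ (w (suc d) (suc m)) n) (F (suc d) (suc m)) (G (suc d) (suc m)))
                        (∑₁-+ n (λ m → δ (w (suc d) m) n * F (suc d) m) (λ m → δ (w (suc d) m) n * G (suc d) m)))
  (∑₁-+ n (λ d → ∑₁ n λ m → δ (w d m) n * F d m) (λ d → ∑₁ n λ m → δ (w d m) n * G d m))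

∑²[]-*ˡ : ∀ w n c (F : ℕ → ℕ → ℚ) → ∑²[ w ≡ n ] (λ d m → c * F d m) ≡ c * ∑²[ w ≡ n ] F
∑²[]-*ˡ w n c F = trans
  (∑-cong n λ d → trans (∑-cong n λ m → x∙yz≈y∙xz (δ (w (suc d) (suc m)) n) c (F (suc d) (suc m)))
                        (∑₁-*ˡ n c (λ m → δ (w (suc d) m) n * F (suc d) m)))
  (∑₁-*ˡ n c (λ d → ∑₁ n λ m → δ (w d m) n * F d m))

∑²[*]-swap : ∀ n (F : ℕ → ℕ → ℚ) → ∑²[ ℕ._*_ ≡ n ] F ≡ ∑²[ ℕ._*_ ≡ n ] (λ d m → F m d)
∑²[*]-swap n F = trans (∑₁-swap n n (λ d m → δ (d ℕ.* m) n * F d m))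
                       (∑-cong n λ d → ∑-cong n λ m → cong (λ k → δ k n * F (suc m) (suc d)) (ℕₚ.*-comm (suc m) (suc d)))

∑²[*]-symmetrize : ∀ n (F G : ℕ → ℕ → ℚ) → (∀ d m → F d m + F m d ≡ G d m + G m d) →
                   ∑²[ ℕ._*_ ≡ n ] F ≡ ∑²[ ℕ._*_ ≡ n ] G
∑²[*]-symmetrize n F G F≈G = begin
  S F                  ≡⟨ half (S F) ⟩
  ½ * (S F + S F)      ≡⟨ cong (½ *_) (twice F) ⟩
  ½ * S (symmetrized F)       ≡⟨ cong (½ *_) (∑²[]-cong ℕ._*_ n {symmetrized F} {symmetrized G} (λ d m → F≈G (suc d) (suc m))) ⟩
  ½ * S (symmetrized G)       ≡⟨ cong (½ *_) (twice G) ⟨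
  ½ * (S G + S G)      ≡⟨ half (S G) ⟨
  S G                  ∎
  where
  S : (ℕ → ℕ → ℚ) → ℚ
  S H = ∑²[ ℕ._*_ ≡ n ] H
  symmetrized : (ℕ → ℕ → ℚ) → ℕ → ℕ → ℚ
  symmetrized H d m = H d m + H m d
  half : ∀ s → s ≡ ½ * (s + s)
  half = solve 1 (λ s → s := con ½ :* (s :+ s)) refl
  twice : ∀ H → S H + S H ≡ S (symmetrized H)
  twice H = trans (cong (_+_ (S H)) (∑²[*]-swap n H)) (sym (∑²[]-+ ℕ._*_ n H (λ d m → H m d)))

∑²[*]-⟦n⟧ : ∀ n (F : ℕ → ℕ → ℚ) → ⟦ n ⟧ * ∑²[ ℕ._*_ ≡ n ] F ≡ ∑²[ ℕ._*_ ≡ n ] (λ d m → ⟦ d ⟧ * ⟦ m ⟧ * F d m)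
∑²[*]-⟦n⟧ n F = trans (sym (∑²[]-*ˡ ℕ._*_ n ⟦ n ⟧ F))
  (∑-cong n λ d → ∑-cong n λ m → δ*-cong (suc d ℕ.* suc m) n λ { refl → cong (_* F (suc d) (suc m)) (⟦⟧-* (suc d) (suc m)) })

private
  ∑₁-δ<-restrict : ∀ n m (g : ℕ → ℚ) → m ℕ.≤ n → ∑₁ n (λ x → δ< x (suc m) * g x) ≡ ∑₁ m g
  ∑₁-δ<-restrict n m g m≤n = begin
    ∑₁ n (λ x → δ< x (suc m) * g x)
      ≡⟨ ∑₁-extend (λ x → δ< x (suc m) * g x) m≤n (λ x m<x → trans (cong (_* g x) (𝟙-no (x ℕ.<? suc m) (ℕₚ.<⇒≱ (s≤s m<x))))
                                                                           (ℚₚ.*-zeroˡ (g x))) ⟩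
    ∑₁ m (λ x → δ< x (suc m) * g x)
      ≡⟨ ∑₁-cong m (λ x _ x≤m → trans (cong (_* g x) (𝟙-yes (x ℕ.<? suc m) (s≤s x≤m))) (ℚₚ.*-identityˡ (g x))) ⟩
    ∑₁ m g  ∎

∑³[ax+ay]-as-divisor-sum : ∀ n (h : ℕ → ℕ → ℕ → ℚ) →
  ∑³[ ax+ay ≡ n ] h ≡ ∑²[ ℕ._*_ ≡ n ] (λ a m → ∑₁ (m ∸ 1) (λ x → h a x (m ∸ x)))
∑³[ax+ay]-as-divisor-sum n h = ∑₁-cong n λ a 1≤a _ → begin
  ∑₁ n (λ x → ∑₁ n (λ y → δ (a ℕ.* (x ℕ.+ y)) n * h a x y))
    ≡⟨ ∑₁-cong n (λ x _ _ → substitute a x 1≤a) ⟩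
  ∑₁ n (λ x → ∑₁ n (λ m → δ< x m * (δ (a ℕ.* m) n * h a x (m ∸ x))))
    ≡⟨ ∑₁-swap n n (λ x m → δ< x m * (δ (a ℕ.* m) n * h a x (m ∸ x))) ⟩
  ∑₁ n (λ m → ∑₁ n (λ x → δ< x m * (δ (a ℕ.* m) n * h a x (m ∸ x))))
    ≡⟨ ∑₁-cong n (λ m 1≤m _ → restrict a m 1≤a 1≤m) ⟩
  ∑₁ n (λ m → δ (a ℕ.* m) n * ∑₁ (m ∸ 1) (λ x → h a x (m ∸ x)))  ∎
  where
  m≤a*m : ∀ m {a} → 1 ℕ.≤ a → m ℕ.≤ a ℕ.* m
  m≤a*m m {a} 1≤a = ℕₚ.≤-trans (m≤m*n⁺ m 1≤a) (ℕₚ.≤-reflexive (ℕₚ.*-comm m a))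
  substitute : ∀ a x → 1 ℕ.≤ a →
    ∑₁ n (λ y → δ (a ℕ.* (x ℕ.+ y)) n * h a x y) ≡ ∑₁ n (λ m → δ< x m * (δ (a ℕ.* m) n * h a x (m ∸ x)))
  substitute a x 1≤a = begin
    ∑₁ n (λ y → δ (a ℕ.* (x ℕ.+ y)) n * h a x y)
      ≡⟨ ∑-cong n (λ y → cong (λ z → δ (a ℕ.* (x ℕ.+ suc y)) n * h a x z) (ℕₚ.m+n∸m≡n x (suc y))) ⟨
    ∑₁ n (λ y → δ (a ℕ.* (x ℕ.+ y)) n * h a x (x ℕ.+ y ∸ x))
      ≡⟨ ∑₁-δ< n x (λ m → δ (a ℕ.* m) n * h a x (m ∸ x)) beyond ⟨
    ∑₁ n (λ m → δ< x m * (δ (a ℕ.* m) n * h a x (m ∸ x)))  ∎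
    where
    beyond : ∀ m → n ℕ.< m → δ (a ℕ.* m) n * h a x (m ∸ x) ≡ 0ℚ
    beyond m n<m = δ*-≢ (h a x (m ∸ x)) (λ am≡n → ℕₚ.<⇒≱ n<m (ℕₚ.≤-trans (m≤a*m m 1≤a) (ℕₚ.≤-reflexive am≡n)))
  restrict : ∀ a m → 1 ℕ.≤ a → 1 ℕ.≤ m →
             ∑₁ n (λ x → δ< x m * (δ (a ℕ.* m) n * h a x (m ∸ x))) ≡ δ (a ℕ.* m) n * ∑₁ (m ∸ 1) (λ x → h a x (m ∸ x))
  restrict a (suc m) 1≤a _ = begin
    ∑₁ n (λ x → δ< x (suc m) * (δ (a ℕ.* suc m) n * h a x (suc m ∸ x)))
      ≡⟨ ∑-cong n (λ x → x∙yz≈y∙xz (δ< (suc x) (suc m)) (δ (a ℕ.* suc m) n) (h a (suc x) (suc m ∸ suc x))) ⟩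
    ∑₁ n (λ x → δ (a ℕ.* suc m) n * (δ< x (suc m) * h a x (suc m ∸ x)))
      ≡⟨ ∑₁-*ˡ n (δ (a ℕ.* suc m) n) (λ x → δ< x (suc m) * h a x (suc m ∸ x)) ⟩
    δ (a ℕ.* suc m) n * ∑₁ n (λ x → δ< x (suc m) * h a x (suc m ∸ x))
      ≡⟨ δ*-cong (a ℕ.* suc m) n (λ am≡n → ∑₁-δ<-restrict n m (λ x → h a x (suc m ∸ x))
                                            (ℕₚ.≤-trans (ℕₚ.n≤1+n m) (ℕₚ.≤-trans (m≤a*m (suc m) 1≤a) (ℕₚ.≤-reflexive am≡n)))) ⟩
    δ (a ℕ.* suc m) n * ∑₁ m (λ x → h a x (suc m ∸ x))  ∎

∑₁-antidifference : ∀ (g G : ℚ → ℚ) → G 0ℚ ≡ 0ℚ → (∀ x → G (x + 1ℚ) ≡ G x + g (x + 1ℚ)) →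
                    ∀ k → ∑₁ k (λ x → g ⟦ x ⟧) ≡ G ⟦ k ⟧
∑₁-antidifference g G G0 _ zero    = sym G0
∑₁-antidifference g G G0 step (suc k) = begin
  ∑₁ (suc k) (λ x → g ⟦ x ⟧)           ≡⟨ ∑-last k (λ i → g ⟦ suc i ⟧) ⟩
  ∑₁ k (λ x → g ⟦ x ⟧) + g ⟦ suc k ⟧   ≡⟨ cong₂ _+_ (∑₁-antidifference g G G0 step k) (cong g (⟦⟧-suc k)) ⟩
  G ⟦ k ⟧ + g (⟦ k ⟧ + 1ℚ)             ≡⟨ step ⟦ k ⟧ ⟨
  G (⟦ k ⟧ + 1ℚ)                       ≡⟨ cong G (⟦⟧-suc k) ⟨
  G ⟦ suc k ⟧                          ∎

private
  ⟦⟧-sum : ∀ m (g h : ℕ → ℕ) → ⟦ sum (map g (applyUpTo h m)) ⟧ ≡ ∑ m (λ i → ⟦ g (h i) ⟧)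
  ⟦⟧-sum zero    g h = refl
  ⟦⟧-sum (suc m) g h = trans (⟦⟧-+ (g (h 0)) _) (cong (_+_ ⟦ g (h 0) ⟧) (⟦⟧-sum m g (λ i → h (suc i))))

  ⟦⟧-if : ∀ {P : Set} (p : Dec P) u → ⟦ if does p then u else 0 ⟧ ≡ 𝟙 p * ⟦ u ⟧
  ⟦⟧-if (yes _) u = sym (ℚₚ.*-identityˡ ⟦ u ⟧)
  ⟦⟧-if (no _)  u = sym (ℚₚ.*-zeroˡ ⟦ u ⟧)

  𝟙-∣ : ∀ N d i → 1 ℕ.≤ i → i ℕ.≤ N → 𝟙 (suc d ∣? i) ≡ ∑₁ N (λ x → δ (suc d ℕ.* x) i)
  𝟙-∣ N d i 1≤i i≤N with suc d ∣? i
  ... | yes d∣i@(divides q i≡qd) = begin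
    𝟙 (suc d ∣? i)                    ≡⟨ 𝟙-yes (suc d ∣? i) d∣i ⟩
    1ℚ                                ≡⟨ ∑₁-δ N q (λ _ → 1ℚ) 1≤q q≤N ⟨
    ∑₁ N (λ x → δ x q * 1ℚ)           ≡⟨ ∑₁-cong N (λ x _ _ → trans (ℚₚ.*-identityʳ (δ x q)) (𝟙-⇔ (x ℕ.≟ q) (suc d ℕ.* x ℕ.≟ i) to from)) ⟩
    ∑₁ N (λ x → δ (suc d ℕ.* x) i)    ∎
    where
    to : ∀ {x} → x ≡ q → suc d ℕ.* x ≡ i
    to refl = trans (ℕₚ.*-comm (suc d) q) (sym i≡qd)
    from : ∀ {x} → suc d ℕ.* x ≡ i → x ≡ q
    from {x} dx≡i = ℕₚ.*-cancelʳ-≡ x q (suc d) (trans (ℕₚ.*-comm x (suc d)) (trans dx≡i i≡qd))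
    positive : ∀ r → i ≡ r ℕ.* suc d → 1 ℕ.≤ r
    positive zero    i≡0 = contradiction (sym i≡0) (ℕₚ.<⇒≢ 1≤i)
    positive (suc _) _   = s≤s z≤n
    1≤q : 1 ℕ.≤ q
    1≤q = positive q i≡qd
    q≤N : q ℕ.≤ N
    q≤N = ℕₚ.≤-trans (ℕₚ.≤-trans (ℕₚ.m≤m*n q (suc d)) (ℕₚ.≤-reflexive (sym i≡qd))) i≤N
  ... | no d∤i = begin
    𝟙 (suc d ∣? i)                    ≡⟨ 𝟙-no (suc d ∣? i) d∤i ⟩
    0ℚ                                ≡⟨ ∑₁-zero N (λ x → δ (suc d ℕ.* x) i) (λ x _ _ → 𝟙-no (suc d ℕ.* x ℕ.≟ i) (d∤i ∘ divisor x)) ⟨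
    ∑₁ N (λ x → δ (suc d ℕ.* x) i)    ∎
    where
    divisor : ∀ x → suc d ℕ.* x ≡ i → suc d ∣ i
    divisor x dx≡i = divides x (trans (sym dx≡i) (ℕₚ.*-comm (suc d) x))

σ-as-divisor-sum : ∀ N k i → i ℕ.≤ N → ⟦ σ k i ⟧ ≡ ∑₁ N (λ d → ∑₁ N (λ x → δ (d ℕ.* x) i * ⟦ d ⟧ ^ k))
σ-as-divisor-sum N k i i≤N = begin
  ⟦ σ k i ⟧
    ≡⟨ ⟦⟧-sum i (λ j → if does (suc j ∣? i) then suc j ℕ.^ k else 0) (λ j → j) ⟩
  ∑ i (λ j → ⟦ if does (suc j ∣? i) then suc j ℕ.^ k else 0 ⟧)
    ≡⟨ ∑-cong< i (λ j j<i → divisor-term j (ℕₚ.≤-trans (s≤s z≤n) j<i) j<i) ⟩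
  ∑₁ i g
    ≡⟨ ∑₁-extend g i≤N (λ d i<d → ∑₁-zero N (λ x → δ (d ℕ.* x) i * ⟦ d ⟧ ^ k)
                          (λ x 1≤x _ → δ*-≢ {d ℕ.* x} {i} (⟦ d ⟧ ^ k) (λ { refl → ℕₚ.<⇒≱ i<d (m≤m*n⁺ d 1≤x) }))) ⟨
  ∑₁ N g  ∎
  where
  g : ℕ → ℚ
  g d = ∑₁ N (λ x → δ (d ℕ.* x) i * ⟦ d ⟧ ^ k)
  divisor-term : ∀ j → 1 ℕ.≤ i → j ℕ.< i → ⟦ if does (suc j ∣? i) then suc j ℕ.^ k else 0 ⟧ ≡ g (suc j)
  divisor-term j 1≤i j<i = begin
    ⟦ if does (suc j ∣? i) then suc j ℕ.^ k else 0 ⟧       ≡⟨ ⟦⟧-if (suc j ∣? i) (suc j ℕ.^ k) ⟩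
    𝟙 (suc j ∣? i) * ⟦ suc j ℕ.^ k ⟧                     ≡⟨ cong₂ _*_ (𝟙-∣ N j i 1≤i i≤N) (⟦⟧-^ (suc j) k) ⟩
    ∑₁ N (λ x → δ (suc j ℕ.* x) i) * ⟦ suc j ⟧ ^ k       ≡⟨ ∑-*ʳ N (⟦ suc j ⟧ ^ k) (λ x → δ (suc j ℕ.* suc x) i) ⟨
    g (suc j)                                            ∎

-- The term i = n vanishes, as σ s 0 = 0.
σ-convolution : ℕ → ℕ → ℕ → ℚ
σ-convolution r s n = ∑₁ n (λ i → ⟦ σ r i ⟧ * ⟦ σ s (n ∸ i) ⟧)

σ-convolution-as-∑⁴ : ∀ r s n → σ-convolution r s n ≡ ∑⁴[ ax+by ≡ n ] (λ a b x y → ⟦ a ⟧ ^ r * ⟦ b ⟧ ^ s)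
σ-convolution-as-∑⁴ r s n = begin
  ∑₁ n (λ i → ⟦ σ r i ⟧ * ⟦ σ s (n ∸ i) ⟧)
    ≡⟨ ∑₁-cong n (λ i _ i≤n → trans (cong₂ _*_ (σ-as-divisor-sum n r i i≤n) (σ-as-divisor-sum n s (n ∸ i) (ℕₚ.m∸n≤m n i)))
                                     (product (λ a x → δ (a ℕ.* x) i * A a) (λ b y → δ (b ℕ.* y) (n ∸ i) * B b))) ⟩
  ∑₁ n (λ i → ∑₁ n λ a → ∑₁ n λ x → ∑₁ n λ b → ∑₁ n λ y → (δ (a ℕ.* x) i * A a) * (δ (b ℕ.* y) (n ∸ i) * B b))
    ≡⟨ sum-inside (λ i a x b y → (δ (a ℕ.* x) i * A a) * (δ (b ℕ.* y) (n ∸ i) * B b)) ⟩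
  (∑₁ n λ a → ∑₁ n λ x → ∑₁ n λ b → ∑₁ n λ y → ∑₁ n (λ i → (δ (a ℕ.* x) i * A a) * (δ (b ℕ.* y) (n ∸ i) * B b)))
    ≡⟨ ∑₁-cong n (λ a 1≤a _ → ∑₁-cong n (λ x 1≤x _ → ∑-cong n λ b → ∑-cong n λ y →
         trans (∑-cong n (λ i → solve 4 (λ p u q v → (p :* u) :* (q :* v) := p :* (q :* (u :* v))) refl
                                        (δ (a ℕ.* x) (suc i)) (A a) (δ (suc b ℕ.* suc y) (n ∸ suc i)) (B (suc b))))
               (∑₁-δ-split (a ℕ.* x) (suc b ℕ.* suc y) (A a * B (suc b)) (ℕₚ.*-mono-≤ 1≤a 1≤x)))) ⟩
  (∑₁ n λ a → ∑₁ n λ x → ∑₁ n λ b → ∑₁ n λ y → δ (a ℕ.* x ℕ.+ b ℕ.* y) n * (A a * B b))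
    ≡⟨ ∑⁴-swap₂₃ n (λ a x b y → δ (a ℕ.* x ℕ.+ b ℕ.* y) n * (A a * B b)) ⟩
  ∑⁴[ ax+by ≡ n ] (λ a b x y → A a * B b)  ∎
  where
  A B : ℕ → ℚ
  A a = ⟦ a ⟧ ^ r
  B b = ⟦ b ⟧ ^ s
  product : ∀ (u v : ℕ → ℕ → ℚ) → (∑₁ n λ a → ∑₁ n λ x → u a x) * (∑₁ n λ b → ∑₁ n λ y → v b y) ≡
                                   (∑₁ n λ a → ∑₁ n λ x → ∑₁ n λ b → ∑₁ n λ y → u a x * v b y)
  product u v = trans (sym (∑-*ʳ n V (λ i → ∑₁ n (u (suc i)))))
    (∑-cong n λ a → trans (sym (∑-*ʳ n V (λ j → u (suc a) (suc j))))
      (∑-cong n λ x → trans (sym (∑-*ˡ n (u (suc a) (suc x)) (λ i → ∑₁ n (v (suc i)))))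
        (∑-cong n λ b → sym (∑-*ˡ n (u (suc a) (suc x)) (λ j → v (suc b) (suc j))))))
    where
    V = ∑₁ n λ b → ∑₁ n λ y → v b y
  sum-inside : ∀ (F : ℕ → ℕ → ℕ → ℕ → ℕ → ℚ) →
    ∑₁ n (λ i → ∑₁ n λ a → ∑₁ n λ x → ∑₁ n λ b → ∑₁ n λ y → F i a x b y) ≡
    (∑₁ n λ a → ∑₁ n λ x → ∑₁ n λ b → ∑₁ n λ y → ∑₁ n (λ i → F i a x b y))
  sum-inside F = trans (∑₁-swap n n (λ i a → ∑₁ n λ x → ∑₁ n λ b → ∑₁ n λ y → F i a x b y))
    (∑-cong n λ a → trans (∑₁-swap n n (λ i x → ∑₁ n λ b → ∑₁ n λ y → F i (suc a) x b y))
      (∑-cong n λ x → trans (∑₁-swap n n (λ i b → ∑₁ n λ y → F i (suc a) (suc x) b y))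
        (∑-cong n λ b → ∑₁-swap n n (λ i y → F i (suc a) (suc x) (suc b) y))))
  ∑₁-δ-split : ∀ p q (C : ℚ) → 1 ℕ.≤ p → ∑₁ n (λ i → δ p i * (δ q (n ∸ i) * C)) ≡ δ (p ℕ.+ q) n * C
  ∑₁-δ-split p q C 1≤p with p ℕ.≤? n
  ... | yes p≤n = begin
    ∑₁ n (λ i → δ p i * (δ q (n ∸ i) * C))   ≡⟨ ∑-cong n (λ i → cong (_* (δ q (n ∸ suc i) * C)) (δ-sym p (suc i))) ⟩
    ∑₁ n (λ i → δ i p * (δ q (n ∸ i) * C))   ≡⟨ ∑₁-δ n p (λ i → δ q (n ∸ i) * C) 1≤p p≤n ⟩
    δ q (n ∸ p) * C                          ≡⟨ cong (_* C) (𝟙-⇔ (q ℕ.≟ n ∸ p) (p ℕ.+ q ℕ.≟ n)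
                                                   (λ { refl → ℕₚ.m+[n∸m]≡n p≤n }) (λ { refl → sym (ℕₚ.m+n∸m≡n p q) })) ⟩
    δ (p ℕ.+ q) n * C                        ∎
  ... | no p≰n = begin
    ∑₁ n (λ i → δ p i * (δ q (n ∸ i) * C))   ≡⟨ ∑-cong n (λ i → cong (_* (δ q (n ∸ suc i) * C)) (δ-sym p (suc i))) ⟩
    ∑₁ n (λ i → δ i p * (δ q (n ∸ i) * C))   ≡⟨ ∑₁-δ-outside n p (λ i → δ q (n ∸ i) * C) (ℕₚ.≰⇒> p≰n) ⟩
    0ℚ                                       ≡⟨ δ*-≢ {p ℕ.+ q} {n} C (λ { refl → p≰n (ℕₚ.m≤m+n p q) }) ⟨
    δ (p ℕ.+ q) n * C                        ∎

-- The sum over the Klein four-group generated by (a b)(x y) and (a x)(b y), which preserves ax + by.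
orbit : {A : Set} → (A → A → A → A → ℚ) → A → A → A → A → ℚ
orbit f a b x y = f a b x y + f b a y x + f x y a b + f y x b a

∑⁴[ax+by]-symmetrize : ∀ n (f g : Fun⁴) → (∀ a b x y → orbit f a b x y ≡ orbit g a b x y) →
                       ∑⁴[ ax+by ≡ n ] f ≡ ∑⁴[ ax+by ≡ n ] g
∑⁴[ax+by]-symmetrize n f g f≈g = begin
  ∑⁴[ ax+by ≡ n ] f                            ≡⟨ quarter _ ⟩
  ¼ * (S f + S f + S f + S f)                  ≡⟨ cong (¼ *_) (sum-orbit f) ⟩
  ¼ * ∑⁴[ ax+by ≡ n ] (orbit f)                ≡⟨ cong (¼ *_) (∑⁴[]-cong ax+by n f≈g) ⟩
  ¼ * ∑⁴[ ax+by ≡ n ] (orbit g)                ≡⟨ cong (¼ *_) (sum-orbit g) ⟨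
  ¼ * (S g + S g + S g + S g)                  ≡⟨ quarter _ ⟨
  ∑⁴[ ax+by ≡ n ] g                            ∎
  where
  S : Fun⁴ → ℚ
  S h = ∑⁴[ ax+by ≡ n ] h
  ¼ : ℚ
  ¼ = + 1 / 4
  quarter : ∀ s → s ≡ ¼ * (s + s + s + s)
  quarter = solve 1 (λ s → s := con ¼ :* (s :+ s :+ s :+ s)) refl
  sum-orbit : ∀ h → S h + S h + S h + S h ≡ S (orbit h)
  sum-orbit h = begin
    S h + S h + S h + S h
      ≡⟨ cong₂ _+_ (cong₂ _+_ (cong (_+_ (S h)) (∑⁴[ax+by]-swap-pairs n h)) (∑⁴[ax+by]-swap-blocks n h))
                   (trans (∑⁴[ax+by]-swap-pairs n h) (∑⁴[ax+by]-swap-blocks n (λ a b x y → h b a y x))) ⟩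
    S h + S (λ a b x y → h b a y x) + S (λ a b x y → h x y a b) + S (λ a b x y → h y x b a)
      ≡⟨ cong (λ s → s + S (λ a b x y → h x y a b) + S (λ a b x y → h y x b a)) (∑⁴[]-+ ax+by n h (λ a b x y → h b a y x)) ⟨
    S (λ a b x y → h a b x y + h b a y x) + S (λ a b x y → h x y a b) + S (λ a b x y → h y x b a)
      ≡⟨ cong (_+ S (λ a b x y → h y x b a)) (∑⁴[]-+ ax+by n (λ a b x y → h a b x y + h b a y x) (λ a b x y → h x y a b)) ⟨
    S (λ a b x y → h a b x y + h b a y x + h x y a b) + S (λ a b x y → h y x b a)
      ≡⟨ ∑⁴[]-+ ax+by n (λ a b x y → h a b x y + h b a y x + h x y a b) (λ a b x y → h y x b a) ⟨
    S (orbit h)  ∎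

-- Polynomials are written as functions on solver syntax, so that the same term can be evaluated
-- and handed to the ring solver.
Poly₂ Poly₃ Poly₄ : Set
Poly₂ = ∀ {k} → Polynomial k → Polynomial k → Polynomial k
Poly₃ = ∀ {k} → Polynomial k → Polynomial k → Polynomial k → Polynomial k
Poly₄ = ∀ {k} → Polynomial k → Polynomial k → Polynomial k → Polynomial k → Polynomial k

eval₂ : Poly₂ → ℚ → ℚ → ℚ
eval₂ p d m = ⟦ p (var (# 0)) (var (# 1)) ⟧ₚ (d ∷ m ∷ [])

eval₃ : Poly₃ → ℚ → ℚ → ℚ → ℚ
eval₃ p a m x = ⟦ p (var (# 0)) (var (# 1)) (var (# 2)) ⟧ₚ (a ∷ m ∷ x ∷ [])

eval₄ : Poly₄ → ℚ → ℚ → ℚ → ℚ → ℚ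
eval₄ p a b x y = ⟦ p (var (# 0)) (var (# 1)) (var (# 2)) (var (# 3)) ⟧ₚ (a ∷ b ∷ x ∷ y ∷ [])

data DivisorTerm : Set where
  σ[_] nσ[_] : ℕ → DivisorTerm

DivisorCombination : Set
DivisorCombination = List (ℚ × DivisorTerm)

divisorTerm : ℕ → ℚ × DivisorTerm → ℚ
divisorTerm n (c , σ[ k ])  = c * ⟦ σ k n ⟧
divisorTerm n (c , nσ[ k ]) = c * (⟦ n ⟧ * ⟦ σ k n ⟧)

valueAt : ℕ → DivisorCombination → ℚ
valueAt n []            = 0ℚ
valueAt n (c ∷ [])      = divisorTerm n c
valueAt n (c ∷ c′ ∷ cs) = divisorTerm n c + valueAt n (c′ ∷ cs)

-- Summing d ^ k over d m = n gives σ k n, summing d m d ^ k gives n σ k n.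
divisorMonomial : ℚ × DivisorTerm → Poly₂
divisorMonomial (c , σ[ k ])  d m = con c :* d :^ k
divisorMonomial (c , nσ[ k ]) d m = con c :* (d :* m :* d :^ k)

divisorPolynomial : DivisorCombination → Poly₂
divisorPolynomial []            d m = con 0ℚ
divisorPolynomial (c ∷ [])      d m = divisorMonomial c d m
divisorPolynomial (c ∷ c′ ∷ cs) d m = divisorMonomial c d m :+ divisorPolynomial (c′ ∷ cs) d m

∑²[*]-divisorMonomial : ∀ n c → ∑²[ ℕ._*_ ≡ n ] (λ d m → eval₂ (divisorMonomial c) ⟦ d ⟧ ⟦ m ⟧) ≡ divisorTerm n c
∑²[*]-divisorMonomial n (c , σ[ k ]) = begin
  ∑²[ ℕ._*_ ≡ n ] (λ d m → c * ⟦ d ⟧ ^ k)               ≡⟨ ∑²[]-*ˡ ℕ._*_ n c (λ d m → ⟦ d ⟧ ^ k) ⟩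
  c * ∑²[ ℕ._*_ ≡ n ] (λ d m → ⟦ d ⟧ ^ k)               ≡⟨ cong (c *_) (σ-as-divisor-sum n k n ℕₚ.≤-refl) ⟨
  c * ⟦ σ k n ⟧                                        ∎
∑²[*]-divisorMonomial n (c , nσ[ k ]) = begin
  ∑²[ ℕ._*_ ≡ n ] (λ d m → c * (⟦ d ⟧ * ⟦ m ⟧ * ⟦ d ⟧ ^ k))  ≡⟨ ∑²[]-*ˡ ℕ._*_ n c (λ d m → ⟦ d ⟧ * ⟦ m ⟧ * ⟦ d ⟧ ^ k) ⟩
  c * ∑²[ ℕ._*_ ≡ n ] (λ d m → ⟦ d ⟧ * ⟦ m ⟧ * ⟦ d ⟧ ^ k)    ≡⟨ cong (c *_) (∑²[*]-⟦n⟧ n (λ d m → ⟦ d ⟧ ^ k)) ⟨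
  c * (⟦ n ⟧ * ∑²[ ℕ._*_ ≡ n ] (λ d m → ⟦ d ⟧ ^ k))          ≡⟨ cong (λ s → c * (⟦ n ⟧ * s)) (σ-as-divisor-sum n k n ℕₚ.≤-refl) ⟨
  c * (⟦ n ⟧ * ⟦ σ k n ⟧)                                   ∎

∑²[*]-divisorPolynomial : ∀ n cs → ∑²[ ℕ._*_ ≡ n ] (λ d m → eval₂ (divisorPolynomial cs) ⟦ d ⟧ ⟦ m ⟧) ≡ valueAt n cs
∑²[*]-divisorPolynomial n [] =
  trans (∑-cong n λ d → trans (∑-cong n λ m → ℚₚ.*-zeroʳ (δ (suc d ℕ.* suc m) n)) (∑-zero n _ λ _ _ → refl))
        (∑-zero n _ λ _ _ → refl)
∑²[*]-divisorPolynomial n (c ∷ [])      = ∑²[*]-divisorMonomial n c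
∑²[*]-divisorPolynomial n (c ∷ c′ ∷ cs) =
  trans (∑²[]-+ ℕ._*_ n (λ d m → eval₂ (divisorMonomial c) ⟦ d ⟧ ⟦ m ⟧) (λ d m → eval₂ (divisorPolynomial (c′ ∷ cs)) ⟦ d ⟧ ⟦ m ⟧))
        (cong₂ _+_ (∑²[*]-divisorMonomial n c) (∑²[*]-divisorPolynomial n (c′ ∷ cs)))

record LiouvilleCertificate (t : Poly₄) (T : DivisorCombination) : Set where
  field
    f : Poly₄
    F : Poly₃
    symmetrization : ∀ a b x y → orbit (eval₄ t) a b x y ≡ orbit (eval₄ f) a b x y
    balanced : ∀ a b x y → eval₄ f (a + b) b x y + eval₄ f b (a + b) y x
                           + (eval₄ f (y + x) x b a + eval₄ f x (y + x) a b) ≡ 0ℚ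
    antidifference-0 : ∀ a m → eval₃ F a m 0ℚ ≡ 0ℚ
    antidifference-step : ∀ a m x → eval₃ F a m (x + 1ℚ) ≡ eval₃ F a m x + eval₄ f a a (x + 1ℚ) (m - (x + 1ℚ))
    divisor-symmetrization : ∀ d m → eval₃ F d m (m - 1ℚ) + eval₃ F m d (d - 1ℚ)
                                     ≡ eval₂ (divisorPolynomial T) d m + eval₂ (divisorPolynomial T) m d

∑⁴[ax+by]-certified : ∀ {t : Poly₄} {T : DivisorCombination} → LiouvilleCertificate t T → ∀ n →
                      ∑⁴[ ax+by ≡ n ] (λ a b x y → eval₄ t ⟦ a ⟧ ⟦ b ⟧ ⟦ x ⟧ ⟦ y ⟧) ≡ valueAt n T
∑⁴[ax+by]-certified {t} {T} cert n = begin
  ∑⁴[ ax+by ≡ n ] tℕ                                             ≡⟨ ∑⁴[ax+by]-symmetrize n tℕ fℕ symmetrizationℕ ⟩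
  ∑⁴[ ax+by ≡ n ] fℕ                                             ≡⟨ liouville n fℕ balancedℕ ⟩
  ∑³[ ax+ay ≡ n ] (λ a x y → fℕ a a x y)                         ≡⟨ ∑³[ax+ay]-as-divisor-sum n (λ a x y → fℕ a a x y) ⟩
  ∑²[ ℕ._*_ ≡ n ] hℕ                                             ≡⟨ ∑²[]-cong ℕ._*_ n {hℕ} {Fℕ} (λ a → antidifference (suc a)) ⟩
  ∑²[ ℕ._*_ ≡ n ] Fℕ                                             ≡⟨ ∑²[*]-symmetrize n Fℕ Tℕ (λ d m → divisor-symmetrization ⟦ d ⟧ ⟦ m ⟧) ⟩
  ∑²[ ℕ._*_ ≡ n ] Tℕ                                             ≡⟨ ∑²[*]-divisorPolynomial n T ⟩
  valueAt n T                                                    ∎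
  where
  open LiouvilleCertificate cert
  tℕ fℕ : Fun⁴
  tℕ a b x y = eval₄ t ⟦ a ⟧ ⟦ b ⟧ ⟦ x ⟧ ⟦ y ⟧
  fℕ a b x y = eval₄ f ⟦ a ⟧ ⟦ b ⟧ ⟦ x ⟧ ⟦ y ⟧
  hℕ Fℕ Tℕ : ℕ → ℕ → ℚ
  hℕ a m = ∑₁ (m ∸ 1) (λ x → fℕ a a x (m ∸ x))
  Fℕ d m = eval₃ F ⟦ d ⟧ ⟦ m ⟧ (⟦ m ⟧ - 1ℚ)
  Tℕ d m = eval₂ (divisorPolynomial T) ⟦ d ⟧ ⟦ m ⟧
  symmetrizationℕ : ∀ a b x y → orbit tℕ a b x y ≡ orbit fℕ a b x y
  symmetrizationℕ a b x y = symmetrization ⟦ a ⟧ ⟦ b ⟧ ⟦ x ⟧ ⟦ y ⟧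
  balancedℕ : ∀ a b x y → fℕ (a ℕ.+ b) b x y + fℕ b (a ℕ.+ b) y x + (fℕ (y ℕ.+ x) x b a + fℕ x (y ℕ.+ x) a b) ≡ 0ℚ
  balancedℕ a b x y rewrite ⟦⟧-+ a b | ⟦⟧-+ y x = balanced ⟦ a ⟧ ⟦ b ⟧ ⟦ x ⟧ ⟦ y ⟧
  antidifference : ∀ a m → ∑₁ m (λ x → fℕ a a x (suc m ∸ x)) ≡ eval₃ F ⟦ a ⟧ ⟦ suc m ⟧ (⟦ suc m ⟧ - 1ℚ)
  antidifference a m = begin
    ∑₁ m (λ x → fℕ a a x (suc m ∸ x))
      ≡⟨ ∑₁-cong m (λ x _ x≤m → cong (eval₄ f ⟦ a ⟧ ⟦ a ⟧ ⟦ x ⟧) (⟦⟧-∸ (ℕₚ.m≤n⇒m≤1+n x≤m))) ⟩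
    ∑₁ m (λ x → eval₄ f ⟦ a ⟧ ⟦ a ⟧ ⟦ x ⟧ (⟦ suc m ⟧ - ⟦ x ⟧))
      ≡⟨ ∑₁-antidifference (λ x → eval₄ f ⟦ a ⟧ ⟦ a ⟧ x (⟦ suc m ⟧ - x)) (eval₃ F ⟦ a ⟧ ⟦ suc m ⟧)
           (antidifference-0 ⟦ a ⟧ ⟦ suc m ⟧) (antidifference-step ⟦ a ⟧ ⟦ suc m ⟧) m ⟩
    eval₃ F ⟦ a ⟧ ⟦ suc m ⟧ ⟦ m ⟧
      ≡⟨ cong (eval₃ F ⟦ a ⟧ ⟦ suc m ⟧) (solve 1 (λ k → k := k :+ con 1ℚ :- con 1ℚ) refl ⟦ m ⟧) ⟩
    eval₃ F ⟦ a ⟧ ⟦ suc m ⟧ (⟦ m ⟧ + 1ℚ - 1ℚ)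
      ≡⟨ cong (λ k → eval₃ F ⟦ a ⟧ ⟦ suc m ⟧ (k - 1ℚ)) (⟦⟧-suc m) ⟨
    eval₃ F ⟦ a ⟧ ⟦ suc m ⟧ (⟦ suc m ⟧ - 1ℚ)  ∎

-- The fields of LiouvilleCertificate as solver equations: for concrete polynomials each field is
-- `solve k …-equation refl`.
module CertificateEquations (t f : Poly₄) (F : Poly₃) (T : DivisorCombination) where
  private
    orbitₚ : Poly₄ → Poly₄
    orbitₚ g a b x y = g a b x y :+ g b a y x :+ g x y a b :+ g y x b a

  symmetrization-equation : ∀ {k} → Polynomial k → Polynomial k → Polynomial k → Polynomial k → Polynomial k × Polynomial k
  symmetrization-equation a b x y = orbitₚ t a b x y := orbitₚ f a b x y

  balanced-equation : ∀ {k} → Polynomial k → Polynomial k → Polynomial k → Polynomial k → Polynomial k × Polynomial k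
  balanced-equation a b x y = f (a :+ b) b x y :+ f b (a :+ b) y x :+ (f (y :+ x) x b a :+ f x (y :+ x) a b) := con 0ℚ

  antidifference-0-equation : ∀ {k} → Polynomial k → Polynomial k → Polynomial k × Polynomial k
  antidifference-0-equation a m = F a m (con 0ℚ) := con 0ℚ

  antidifference-step-equation : ∀ {k} → Polynomial k → Polynomial k → Polynomial k → Polynomial k × Polynomial k
  antidifference-step-equation a m x = F a m (x :+ con 1ℚ) := F a m x :+ f a a (x :+ con 1ℚ) (m :- (x :+ con 1ℚ))

  divisor-symmetrization-equation : ∀ {k} → Polynomial k → Polynomial k → Polynomial k × Polynomial k
  divisor-symmetrization-equation d m =
    F d m (m :- con 1ℚ) :+ F m d (d :- con 1ℚ) := divisorPolynomial T d m :+ divisorPolynomial T m d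

-- Convolution sums and Ramanujan's equations

σ₁⋆σ₁ : ∀ n → σ-convolution 1 1 n ≡ (+ 5 / 12) * ⟦ σ 3 n ⟧ + ((+ 1 / 12) * ⟦ σ 1 n ⟧ + (- ½) * (⟦ n ⟧ * ⟦ σ 1 n ⟧))
σ₁⋆σ₁ n = trans (σ-convolution-as-∑⁴ 1 1 n) (∑⁴[ax+by]-certified certificate n)
  where
  t f : Poly₄
  t a b x y = a :^ 1 :* b :^ 1
  f a b x y = y :^ 2 :+ con ½ :* x :* y :- b :^ 2 :+ con ½ :* a :* b
  F : Poly₃
  F a m x = con (+ 1 / 12) :* x :+ con (+ 1 / 4) :* x :^ 2 :+ con (+ 1 / 6) :* x :^ 3 :- con (+ 3 / 4) :* m :* x
            :- con (+ 3 / 4) :* m :* x :^ 2 :+ m :^ 2 :* x :- con ½ :* a :^ 2 :* x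
  T : DivisorCombination
  T = (+ 5 / 12 , σ[ 3 ]) ∷ (+ 1 / 12 , σ[ 1 ]) ∷ (- ½ , nσ[ 1 ]) ∷ []
  open CertificateEquations t f F T
  certificate : LiouvilleCertificate t T
  certificate = record
    { f = f
    ; F = F
    ; symmetrization = solve 4 symmetrization-equation refl
    ; balanced = solve 4 balanced-equation refl
    ; antidifference-0 = solve 2 antidifference-0-equation refl
    ; antidifference-step = solve 3 antidifference-step-equation refl
    ; divisor-symmetrization = solve 2 divisor-symmetrization-equation refl
    }

σ₁⋆σ₃ : ∀ n → σ-convolution 1 3 n ≡
              (+ 7 / 80) * ⟦ σ 5 n ⟧
              + ((+ 1 / 24) * ⟦ σ 3 n ⟧ + ((- (+ 1 / 240)) * ⟦ σ 1 n ⟧ + (- (+ 1 / 8)) * (⟦ n ⟧ * ⟦ σ 3 n ⟧)))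
σ₁⋆σ₃ n = trans (σ-convolution-as-∑⁴ 1 3 n) (∑⁴[ax+by]-certified certificate n)
  where
  t f : Poly₄
  t a b x y = a :^ 1 :* b :^ 3
  f a b x y = con (+ 1 / 4) :* y :^ 4 :+ con ½ :* x :* y :^ 3 :+ con (+ 3 / 8) :* x :^ 2 :* y :^ 2
              :- con (+ 1 / 4) :* b :^ 4 :+ con ½ :* a :* b :^ 3 :- con (+ 3 / 8) :* a :^ 2 :* b :^ 2
  F : Poly₃
  F a m x = con (+ 1 / 24) :* x :^ 3 :+ con (+ 1 / 16) :* x :^ 4 :+ con (+ 1 / 40) :* x :^ 5 :- con (+ 1 / 240) :* x
            :- con (+ 1 / 16) :* m :* x :^ 2 :- con (+ 1 / 8) :* m :* x :^ 3 :- con (+ 1 / 16) :* m :* x :^ 4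
            :+ con (+ 1 / 16) :* m :^ 2 :* x :+ con (+ 3 / 16) :* m :^ 2 :* x :^ 2 :+ con (+ 1 / 8) :* m :^ 2 :* x :^ 3
            :- con (+ 1 / 4) :* m :^ 3 :* x :- con (+ 1 / 4) :* m :^ 3 :* x :^ 2 :+ con (+ 1 / 4) :* m :^ 4 :* x
            :- con (+ 1 / 8) :* a :^ 4 :* x
  T : DivisorCombination
  T = (+ 7 / 80 , σ[ 5 ]) ∷ (+ 1 / 24 , σ[ 3 ]) ∷ (- (+ 1 / 240) , σ[ 1 ]) ∷ (- (+ 1 / 8) , nσ[ 3 ]) ∷ []
  open CertificateEquations t f F T
  certificate : LiouvilleCertificate t T
  certificate = record
    { f = f
    ; F = F
    ; symmetrization = solve 4 symmetrization-equation refl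
    ; balanced = solve 4 balanced-equation refl
    ; antidifference-0 = solve 2 antidifference-0-equation refl
    ; antidifference-step = solve 3 antidifference-step-equation refl
    ; divisor-symmetrization = solve 2 divisor-symmetrization-equation refl
    }

σ₁⋆σ₅-σ₃⋆σ₃ : ∀ n → ⟦ 12096 ⟧ * σ-convolution 1 5 n + (- ⟦ 57600 ⟧) * σ-convolution 3 3 n ≡
                    (- ⟦ 1008 ⟧) * (⟦ n ⟧ * ⟦ σ 5 n ⟧)
                    + (⟦ 24 ⟧ * ⟦ σ 1 n ⟧ + (⟦ 504 ⟧ * ⟦ σ 5 n ⟧ + ⟦ 480 ⟧ * ⟦ σ 3 n ⟧))
σ₁⋆σ₅-σ₃⋆σ₃ n = begin
  ⟦ 12096 ⟧ * σ-convolution 1 5 n + (- ⟦ 57600 ⟧) * σ-convolution 3 3 n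
    ≡⟨ cong₂ (λ p q → ⟦ 12096 ⟧ * p + (- ⟦ 57600 ⟧) * q) (σ-convolution-as-∑⁴ 1 5 n) (σ-convolution-as-∑⁴ 3 3 n) ⟩
  ⟦ 12096 ⟧ * ∑⁴[ ax+by ≡ n ] g₁₅ + (- ⟦ 57600 ⟧) * ∑⁴[ ax+by ≡ n ] g₃₃
    ≡⟨ cong₂ _+_ (∑⁴[]-*ˡ ax+by n ⟦ 12096 ⟧ g₁₅) (∑⁴[]-*ˡ ax+by n (- ⟦ 57600 ⟧) g₃₃) ⟨
  ∑⁴[ ax+by ≡ n ] (λ a b x y → ⟦ 12096 ⟧ * g₁₅ a b x y) + ∑⁴[ ax+by ≡ n ] (λ a b x y → (- ⟦ 57600 ⟧) * g₃₃ a b x y)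
    ≡⟨ ∑⁴[]-+ ax+by n (λ a b x y → ⟦ 12096 ⟧ * g₁₅ a b x y) (λ a b x y → (- ⟦ 57600 ⟧) * g₃₃ a b x y) ⟨
  ∑⁴[ ax+by ≡ n ] (λ a b x y → eval₄ t ⟦ a ⟧ ⟦ b ⟧ ⟦ x ⟧ ⟦ y ⟧)
    ≡⟨ ∑⁴[ax+by]-certified certificate n ⟩
  valueAt n T  ∎
  where
  g₁₅ g₃₃ : Fun⁴
  g₁₅ a b x y = ⟦ a ⟧ ^ 1 * ⟦ b ⟧ ^ 5
  g₃₃ a b x y = ⟦ a ⟧ ^ 3 * ⟦ b ⟧ ^ 3
  t f : Poly₄
  t a b x y = con ⟦ 12096 ⟧ :* (a :^ 1 :* b :^ 5) :+ con (- ⟦ 57600 ⟧) :* (a :^ 3 :* b :^ 3)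
  f a b x y = con ⟦ 2016 ⟧ :* y :^ 6 :+ con ⟦ 6048 ⟧ :* x :* y :^ 5 :- con ⟦ 23760 ⟧ :* x :^ 2 :* y :^ 4
              :- con ⟦ 28800 ⟧ :* x :^ 3 :* y :^ 3 :- con ⟦ 2016 ⟧ :* b :^ 6 :+ con ⟦ 6048 ⟧ :* a :* b :^ 5
              :+ con ⟦ 23760 ⟧ :* a :^ 2 :* b :^ 4 :- con ⟦ 28800 ⟧ :* a :^ 3 :* b :^ 3
  F : Poly₃
  F a m x = con ⟦ 24 ⟧ :* x :- con ⟦ 168 ⟧ :* x :^ 3 :+ con ⟦ 504 ⟧ :* x :^ 5 :+ con ⟦ 504 ⟧ :* x :^ 6 :+ con ⟦ 144 ⟧ :* x :^ 7
            :- con ⟦ 2232 ⟧ :* m :* x :^ 2 :+ con ⟦ 11160 ⟧ :* m :* x :^ 4 :+ con ⟦ 13392 ⟧ :* m :* x :^ 5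
            :+ con ⟦ 4464 ⟧ :* m :* x :^ 6 :+ con ⟦ 2880 ⟧ :* m :^ 2 :* x :- con ⟦ 28800 ⟧ :* m :^ 2 :* x :^ 3
            :- con ⟦ 43200 ⟧ :* m :^ 2 :* x :^ 4 :- con ⟦ 17280 ⟧ :* m :^ 2 :* x :^ 5 :+ con ⟦ 21600 ⟧ :* m :^ 3 :* x :^ 2
            :+ con ⟦ 43200 ⟧ :* m :^ 3 :* x :^ 3 :+ con ⟦ 21600 ⟧ :* m :^ 3 :* x :^ 4 :- con ⟦ 3960 ⟧ :* m :^ 4 :* x
            :- con ⟦ 11880 ⟧ :* m :^ 4 :* x :^ 2 :- con ⟦ 7920 ⟧ :* m :^ 4 :* x :^ 3 :- con ⟦ 3024 ⟧ :* m :^ 5 :* x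
            :- con ⟦ 3024 ⟧ :* m :^ 5 :* x :^ 2 :+ con ⟦ 2016 ⟧ :* m :^ 6 :* x :- con ⟦ 1008 ⟧ :* a :^ 6 :* x
  T : DivisorCombination
  T = (- ⟦ 1008 ⟧ , nσ[ 5 ]) ∷ (⟦ 24 ⟧ , σ[ 1 ]) ∷ (⟦ 504 ⟧ , σ[ 5 ]) ∷ (⟦ 480 ⟧ , σ[ 3 ]) ∷ []
  open CertificateEquations t f F T
  certificate : LiouvilleCertificate t T
  certificate = record
    { f = f
    ; F = F
    ; symmetrization = solve 4 symmetrization-equation refl
    ; balanced = solve 4 balanced-equation refl
    ; antidifference-0 = solve 2 antidifference-0-equation refl
    ; antidifference-step = solve 3 antidifference-step-equation refl
    ; divisor-symmetrization = solve 2 divisor-symmetrization-equation refl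
    }

record DivisorSeries (α : ℚ) (r : ℕ) (u : Series) : Set where
  constructor divisorSeries
  field
    constant-term : u 0 ≡ 1ℚ
    coefficient   : ∀ n → u (suc n) ≡ α * ⟦ σ r (suc n) ⟧

⊗-DivisorSeries : ∀ {α β r s u v} → DivisorSeries α r u → DivisorSeries β s v →
                  ∀ n → (u ⊗ v) (suc n) ≡ u (suc n) + v (suc n) + α * β * σ-convolution r s (suc n)
⊗-DivisorSeries {α} {β} {r} {s} {u} {v} (divisorSeries u₀ uₙ) (divisorSeries v₀ vₙ) n = begin
  (u ⊗ v) (suc n)
    ≡⟨ ⊗-∑ u v (suc n) ⟩
  u 0 * v (suc n) + ∑₁ (suc n) g
    ≡⟨ cong₂ _+_ (trans (cong (_* v (suc n)) u₀) (ℚₚ.*-identityˡ (v (suc n)))) (∑-last n (λ i → g (suc i))) ⟩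
  v (suc n) + (∑₁ n g + g (suc n))
    ≡⟨ cong₂ (λ p q → v (suc n) + (p + q)) (trans (∑₁-cong n middle) (∑₁-*ˡ n (α * β) c)) last ⟩
  v (suc n) + (α * β * ∑₁ n c + u (suc n))
    ≡⟨ solve 4 (λ V ab C U → V :+ (ab :* C :+ U) := U :+ V :+ ab :* (C :+ con 0ℚ)) refl (v (suc n)) (α * β) (∑₁ n c) (u (suc n)) ⟩
  u (suc n) + v (suc n) + α * β * (∑₁ n c + 0ℚ)
    ≡⟨ cong (λ z → u (suc n) + v (suc n) + α * β * (∑₁ n c + z)) c-last ⟨
  u (suc n) + v (suc n) + α * β * (∑₁ n c + c (suc n))
    ≡⟨ cong (λ z → u (suc n) + v (suc n) + α * β * z) (∑-last n (λ i → c (suc i))) ⟨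
  u (suc n) + v (suc n) + α * β * σ-convolution r s (suc n)  ∎
  where
  g c : ℕ → ℚ
  g i = u i * v (suc n ∸ i)
  c i = ⟦ σ r i ⟧ * ⟦ σ s (suc n ∸ i) ⟧
  c-last : c (suc n) ≡ 0ℚ
  c-last = trans (cong (λ k → ⟦ σ r (suc n) ⟧ * ⟦ σ s k ⟧) (ℕₚ.n∸n≡0 n)) (ℚₚ.*-zeroʳ ⟦ σ r (suc n) ⟧)
  last : g (suc n) ≡ u (suc n)
  last = trans (cong (λ k → u (suc n) * v k) (ℕₚ.n∸n≡0 (suc n))) (trans (cong (u (suc n) *_) v₀) (ℚₚ.*-identityʳ (u (suc n))))
  middle : ∀ i → 1 ℕ.≤ i → i ℕ.≤ n → g i ≡ α * β * c i
  middle (suc i) _ i<n = begin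
    u (suc i) * v (suc n ∸ suc i)                     ≡⟨ cong (λ k → u (suc i) * v k) (ℕₚ.+-∸-assoc 1 i<n) ⟩
    u (suc i) * v (suc (n ∸ suc i))                   ≡⟨ cong₂ _*_ (uₙ i) (vₙ (n ∸ suc i)) ⟩
    α * ⟦ σ r (suc i) ⟧ * (β * ⟦ σ s (suc (n ∸ suc i)) ⟧)
      ≡⟨ solve 4 (λ a b p q → a :* p :* (b :* q) := a :* b :* (p :* q)) refl α β ⟦ σ r (suc i) ⟧ _ ⟩
    α * β * (⟦ σ r (suc i) ⟧ * ⟦ σ s (suc (n ∸ suc i)) ⟧)
      ≡⟨ cong (λ k → α * β * (⟦ σ r (suc i) ⟧ * ⟦ σ s k ⟧)) (ℕₚ.+-∸-assoc 1 i<n) ⟨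
    α * β * c (suc i)                                 ∎

E₂-DivisorSeries : DivisorSeries (- ⟦ 24 ⟧) 1 E₂
E₂-DivisorSeries = divisorSeries refl λ n → ℚₚ.neg-distribˡ-* ⟦ 24 ⟧ ⟦ σ 1 (suc n) ⟧

E₄-DivisorSeries : DivisorSeries ⟦ 240 ⟧ 3 E₄
E₄-DivisorSeries = divisorSeries refl λ n → refl

E₆-DivisorSeries : DivisorSeries (- ⟦ 504 ⟧) 5 E₆
E₆-DivisorSeries = divisorSeries refl λ n → ℚₚ.neg-distribˡ-* ⟦ 504 ⟧ ⟦ σ 5 (suc n) ⟧

ramanujan-E₂ : D E₂ ≈ eval (∂ e₂)
ramanujan-E₂ = mk≈ λ { zero → refl ; (suc k) → coefficient k }
  where
  coefficient : ∀ k → ⟦ suc k ⟧ * E₂ (suc k) ≡ (+ 1 / 12) * ((E₂ ⊗ E₂) (suc k) - E₄ (suc k))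
  coefficient k = begin
    ⟦ n ⟧ * E₂ n
      ≡⟨ solve 3 (λ N s₁ s₃ → N :* :- (con ⟦ 24 ⟧ :* s₁) :=
                   con (+ 1 / 12) :* (:- (con ⟦ 24 ⟧ :* s₁) :+ :- (con ⟦ 24 ⟧ :* s₁)
                     :+ con (- ⟦ 24 ⟧ * - ⟦ 24 ⟧) :* (con (+ 5 / 12) :* s₃ :+ (con (+ 1 / 12) :* s₁ :+ con (- ½) :* (N :* s₁)))
                     :- con ⟦ 240 ⟧ :* s₃)) refl ⟦ n ⟧ s₁ s₃ ⟩
    (+ 1 / 12) * (E₂ n + E₂ n + (- ⟦ 24 ⟧ * - ⟦ 24 ⟧) * ((+ 5 / 12) * s₃ + ((+ 1 / 12) * s₁ + (- ½) * (⟦ n ⟧ * s₁))) - E₄ n)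
      ≡⟨ cong (λ c → (+ 1 / 12) * (E₂ n + E₂ n + (- ⟦ 24 ⟧ * - ⟦ 24 ⟧) * c - E₄ n)) (σ₁⋆σ₁ n) ⟨
    (+ 1 / 12) * (E₂ n + E₂ n + (- ⟦ 24 ⟧ * - ⟦ 24 ⟧) * σ-convolution 1 1 n - E₄ n)
      ≡⟨ cong (λ c → (+ 1 / 12) * (c - E₄ n)) (⊗-DivisorSeries E₂-DivisorSeries E₂-DivisorSeries k) ⟨
    (+ 1 / 12) * ((E₂ ⊗ E₂) n - E₄ n)  ∎
    where
    n = suc k
    s₁ = ⟦ σ 1 n ⟧
    s₃ = ⟦ σ 3 n ⟧

ramanujan-E₄ : D E₄ ≈ eval (∂ e₄)
ramanujan-E₄ = mk≈ λ { zero → refl ; (suc k) → coefficient k }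
  where
  coefficient : ∀ k → ⟦ suc k ⟧ * E₄ (suc k) ≡ (+ 1 / 3) * ((E₂ ⊗ E₄) (suc k) - E₆ (suc k))
  coefficient k = begin
    ⟦ n ⟧ * E₄ n
      ≡⟨ solve 4 (λ N s₁ s₃ s₅ → N :* (con ⟦ 240 ⟧ :* s₃) :=
                   con (+ 1 / 3) :* (:- (con ⟦ 24 ⟧ :* s₁) :+ con ⟦ 240 ⟧ :* s₃
                     :+ con (- ⟦ 24 ⟧ * ⟦ 240 ⟧) :* (con (+ 7 / 80) :* s₅ :+ (con (+ 1 / 24) :* s₃
                          :+ (con (- (+ 1 / 240)) :* s₁ :+ con (- (+ 1 / 8)) :* (N :* s₃))))
                     :- :- (con ⟦ 504 ⟧ :* s₅))) refl ⟦ n ⟧ s₁ s₃ s₅ ⟩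
    (+ 1 / 3) * (E₂ n + E₄ n + (- ⟦ 24 ⟧ * ⟦ 240 ⟧)
                   * ((+ 7 / 80) * s₅ + ((+ 1 / 24) * s₃ + ((- (+ 1 / 240)) * s₁ + (- (+ 1 / 8)) * (⟦ n ⟧ * s₃)))) - E₆ n)
      ≡⟨ cong (λ c → (+ 1 / 3) * (E₂ n + E₄ n + (- ⟦ 24 ⟧ * ⟦ 240 ⟧) * c - E₆ n)) (σ₁⋆σ₃ n) ⟨
    (+ 1 / 3) * (E₂ n + E₄ n + (- ⟦ 24 ⟧ * ⟦ 240 ⟧) * σ-convolution 1 3 n - E₆ n)
      ≡⟨ cong (λ c → (+ 1 / 3) * (c - E₆ n)) (⊗-DivisorSeries E₂-DivisorSeries E₄-DivisorSeries k) ⟨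
    (+ 1 / 3) * ((E₂ ⊗ E₄) n - E₆ n)  ∎
    where
    n = suc k
    s₁ = ⟦ σ 1 n ⟧
    s₃ = ⟦ σ 3 n ⟧
    s₅ = ⟦ σ 5 n ⟧

ramanujan-E₆ : D E₆ ≈ eval (∂ e₆)
ramanujan-E₆ = mk≈ λ { zero → refl ; (suc k) → coefficient k }
  where
  coefficient : ∀ k → ⟦ suc k ⟧ * E₆ (suc k) ≡ ½ * ((E₂ ⊗ E₆) (suc k) - (E₄ ⊗ E₄) (suc k))
  coefficient k = begin
    ⟦ n ⟧ * E₆ n
      ≡⟨ solve 4 (λ N s₁ s₃ s₅ → N :* :- (con ⟦ 504 ⟧ :* s₅) :=
                   con ½ :* (:- (con ⟦ 24 ⟧ :* s₁) :+ :- (con ⟦ 504 ⟧ :* s₅) :- (con ⟦ 240 ⟧ :* s₃ :+ con ⟦ 240 ⟧ :* s₃)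
                     :+ (con (- ⟦ 1008 ⟧) :* (N :* s₅) :+ (con ⟦ 24 ⟧ :* s₁ :+ (con ⟦ 504 ⟧ :* s₅ :+ con ⟦ 480 ⟧ :* s₃)))))
                 refl ⟦ n ⟧ s₁ s₃ s₅ ⟩
    ½ * (E₂ n + E₆ n - (E₄ n + E₄ n)
           + ((- ⟦ 1008 ⟧) * (⟦ n ⟧ * s₅) + (⟦ 24 ⟧ * s₁ + (⟦ 504 ⟧ * s₅ + ⟦ 480 ⟧ * s₃))))
      ≡⟨ cong (λ c → ½ * (E₂ n + E₆ n - (E₄ n + E₄ n) + c)) (σ₁⋆σ₅-σ₃⋆σ₃ n) ⟨
    ½ * (E₂ n + E₆ n - (E₄ n + E₄ n) + (⟦ 12096 ⟧ * c₁₅ + (- ⟦ 57600 ⟧) * c₃₃))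
      ≡⟨ solve 5 (λ e₂ e₄ e₆ c₁₅ c₃₃ →
                   con ½ :* (e₂ :+ e₆ :- (e₄ :+ e₄) :+ (con ⟦ 12096 ⟧ :* c₁₅ :+ con (- ⟦ 57600 ⟧) :* c₃₃)) :=
                   con ½ :* (e₂ :+ e₆ :+ con (- ⟦ 24 ⟧ * - ⟦ 504 ⟧) :* c₁₅ :- (e₄ :+ e₄ :+ con (⟦ 240 ⟧ * ⟦ 240 ⟧) :* c₃₃)))
                 refl (E₂ n) (E₄ n) (E₆ n) c₁₅ c₃₃ ⟩
    ½ * (E₂ n + E₆ n + (- ⟦ 24 ⟧ * - ⟦ 504 ⟧) * c₁₅ - (E₄ n + E₄ n + (⟦ 240 ⟧ * ⟦ 240 ⟧) * c₃₃))
      ≡⟨ cong₂ (λ p q → ½ * (p - q)) (⊗-DivisorSeries E₂-DivisorSeries E₆-DivisorSeries k)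
                                     (⊗-DivisorSeries E₄-DivisorSeries E₄-DivisorSeries k) ⟨
    ½ * ((E₂ ⊗ E₆) n - (E₄ ⊗ E₄) n)  ∎
    where
    n = suc k
    s₁ = ⟦ σ 1 n ⟧
    s₃ = ⟦ σ 3 n ⟧
    s₅ = ⟦ σ 5 n ⟧
    c₁₅ = σ-convolution 1 5 n
    c₃₃ = σ-convolution 3 3 n

ramanujan : RamanujanEquations
ramanujan = ramanujan-E₂ , ramanujan-E₄ , ramanujan-E₆

-- Syntactic copies of the forms of Defs: eval x₄₂ reduces to X₄₂, and so on.
x₄₂ x₆₁ x₈₁ x₁₂₁ x₈₂ x₁₀₂ x₁₂₂ x₁₄₂ : Expr
x₄₂  = (+ 1 / 288) ∙ (e₄ ⊟ e₂ ⊠ e₂)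
x₆₁  = (+ 1 / 720) ∙ (e₂ ⊠ e₄ ⊟ e₆)
x₈₁  = (+ 1 / 1008) ∙ (e₄ ⊠ e₄ ⊟ e₂ ⊠ e₆)
x₁₂₁ = (+ 1 / 3991680) ∙ (⟦ 5 ⟧ ∙ e₄ ⊠ e₄ ⊠ e₄ ⊞ ⟦ 7 ⟧ ∙ e₆ ⊠ e₆ ⊟ ⟦ 12 ⟧ ∙ e₂ ⊠ e₄ ⊠ e₆)
x₈₂  = (+ 1 / 362880) ∙ (⟦ 2 ⟧ ∙ e₂ ⊠ e₆ ⊞ ⟦ 5 ⟧ ∙ e₄ ⊠ e₄ ⊟ ⟦ 7 ⟧ ∙ e₂ ⊠ e₂ ⊠ e₄)
x₁₀₂ = (+ 1 / 1088640) ∙ (⟦ 5 ⟧ ∙ e₂ ⊠ e₂ ⊠ e₆ ⊞ ⟦ 2 ⟧ ∙ e₂ ⊠ e₄ ⊠ e₄ ⊟ ⟦ 7 ⟧ ∙ e₄ ⊠ e₆)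
x₁₂₂ = (+ 1 / 798336000) ∙ (⟦ 34 ⟧ ∙ e₂ ⊠ e₄ ⊠ e₆ ⊞ ⟦ 50 ⟧ ∙ e₄ ⊠ e₄ ⊠ e₄
                             ⊟ ⟦ 77 ⟧ ∙ e₂ ⊠ e₂ ⊠ e₄ ⊠ e₄ ⊟ ⟦ 7 ⟧ ∙ e₆ ⊠ e₆)
x₁₄₂ = (+ 1 / 415134720) ∙ (⟦ 13 ⟧ ∙ e₂ ⊠ e₂ ⊠ e₄ ⊠ e₆ ⊞ e₂ ⊠ e₄ ⊠ e₄ ⊠ e₄
                             ⊟ ⟦ 3 ⟧ ∙ e₂ ⊠ e₆ ⊠ e₆ ⊟ ⟦ 11 ⟧ ∙ e₄ ⊠ e₄ ⊠ e₆)

D-X₈₂ : D X₈₂ ≈ ⟦ 2 ⟧ · X₄₂ ⊗ X₆₁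
D-X₈₂ = ≈-trans (D-eval ramanujan x₈₂) (eval-≈ (∂ x₈₂) (⟦ 2 ⟧ ∙ x₄₂ ⊠ x₆₁) ≈-refl)

D-X₁₀₂ : D X₁₀₂ ≈ (+ 8 / 9) · X₄₂ ⊗ X₈₁ ⊕ (+ 10 / 9) · X₆₁ ⊗ X₆₁
D-X₁₀₂ = ≈-trans (D-eval ramanujan x₁₀₂)
                 (eval-≈ (∂ x₁₀₂) ((+ 8 / 9) ∙ x₄₂ ⊠ x₈₁ ⊞ (+ 10 / 9) ∙ x₆₁ ⊠ x₆₁) ≈-refl)

D-X₁₂₂ : D X₁₂₂ ≈ ⟦ 3 ⟧ · X₆₁ ⊗ X₈₂
D-X₁₂₂ = ≈-trans (D-eval ramanujan x₁₂₂) (eval-≈ (∂ x₁₂₂) (⟦ 3 ⟧ ∙ x₆₁ ⊠ x₈₂) ≈-refl)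

D-X₁₄₂ : D X₁₄₂ ≈ ⟦ 3 ⟧ · X₄₂ ⊗ X₁₂₁
D-X₁₄₂ = ≈-trans (D-eval ramanujan x₁₄₂) (eval-≈ (∂ x₁₄₂) (⟦ 3 ⟧ ∙ x₄₂ ⊠ x₁₂₁) ≈-refl)

D-X₁₂₁ : D X₁₂₁ ≈ ⟦ 2 ⟧ · X₆₁ ⊗ X₈₁
D-X₁₂₁ = ≈-trans (D-eval ramanujan x₁₂₁) (eval-≈ (∂ x₁₂₁) (⟦ 2 ⟧ ∙ x₆₁ ⊠ x₈₁) ≈-refl)

X₄₂≈D-E₂ : X₄₂ ≈ (- (+ 1 / 24)) · D E₂
X₄₂≈D-E₂ = ≈-trans (eval-≈ x₄₂ ((- (+ 1 / 24)) ∙ ∂ e₂) ≈-refl) (·-cong {c = - (+ 1 / 24)} (≈-sym ramanujan-E₂))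

X₆₁≈D-E₄ : X₆₁ ≈ (+ 1 / 240) · D E₄
X₆₁≈D-E₄ = ≈-trans (eval-≈ x₆₁ ((+ 1 / 240) ∙ ∂ e₄) ≈-refl) (·-cong {c = + 1 / 240} (≈-sym ramanujan-E₄))

X₈₁≈D-E₆ : X₈₁ ≈ (- (+ 1 / 504)) · D E₆
X₈₁≈D-E₆ = ≈-trans (eval-≈ x₈₁ ((- (+ 1 / 504)) ∙ ∂ e₆) ≈-refl) (·-cong {c = - (+ 1 / 504)} (≈-sym ramanujan-E₆))

-- Complete positivity

nonNeg-* : ∀ {p q} → 0ℚ ≤ p → 0ℚ ≤ q → 0ℚ ≤ p * q
nonNeg-* {p} {q} p≥0 q≥0 =
  ℚₚ.nonNegative⁻¹ (p * q) {{ℚₚ.nonNeg*nonNeg⇒nonNeg p {{nonNegative p≥0}} q {{nonNegative q≥0}}}}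

nonNeg! : (c : ℚ) → {True (0ℚ ℚₚ.≤? c)} → 0ℚ ≤ c
nonNeg! c {c≥0} = toWitness c≥0

CP-≈ : ∀ {f g} → f ≈ g → CompletelyPositive g → CompletelyPositive f
CP-≈ (mk≈ f≋g) g≥0 n = subst (0ℚ ≤_) (sym (f≋g n)) (g≥0 n)

CP-· : ∀ {f} c → 0ℚ ≤ c → CompletelyPositive f → CompletelyPositive (c · f)
CP-· c c≥0 f≥0 n = nonNeg-* c≥0 (f≥0 n)

CP-⊕ : ∀ {f g} → CompletelyPositive f → CompletelyPositive g → CompletelyPositive (f ⊕ g)
CP-⊕ f≥0 g≥0 n = ℚₚ.+-mono-≤ (f≥0 n) (g≥0 n)

CP-⊗ : ∀ {f g} → CompletelyPositive f → CompletelyPositive g → CompletelyPositive (f ⊗ g)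
CP-⊗ {f} {g} f≥0 g≥0 n =
  subst (0ℚ ≤_) (sym (⊗-∑ f g n)) (∑-nonNeg (suc n) (λ i → f i * g (n ∸ i)) (λ i → nonNeg-* (f≥0 i) (g≥0 (n ∸ i))))

CP-from-D : ∀ {f g} → D f ≈ g → CompletelyPositive g → 0ℚ ≤ f 0 → CompletelyPositive f
CP-from-D _ _ f₀≥0 zero    = f₀≥0
CP-from-D {f} Df≈g g≥0 f₀≥0 (suc k) =
  ℚₚ.*-cancelˡ-≤-pos ⟦ suc k ⟧ {{ℚₚ.normalize-pos (suc k) 1}}
    (subst (_≤ ⟦ suc k ⟧ * f (suc k)) (sym (ℚₚ.*-zeroʳ ⟦ suc k ⟧)) (CP-≈ Df≈g g≥0 (suc k)))

CP-D-DivisorSeries : ∀ {α r u} c → DivisorSeries α r u → 0ℚ ≤ c * α → CompletelyPositive (c · D u)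
CP-D-DivisorSeries {u = u} c _ _ zero =
  subst (0ℚ ≤_) (sym (trans (cong (c *_) (ℚₚ.*-zeroˡ (u 0))) (ℚₚ.*-zeroʳ c))) ℚₚ.≤-refl
CP-D-DivisorSeries {α} {r} {u} c u-series cα≥0 (suc k) = subst (0ℚ ≤_) (sym coefficient)
  (nonNeg-* cα≥0 (nonNeg-* (⟦⟧-nonNeg (suc k)) (⟦⟧-nonNeg (σ r (suc k)))))
  where
  coefficient : c * (⟦ suc k ⟧ * u (suc k)) ≡ c * α * (⟦ suc k ⟧ * ⟦ σ r (suc k) ⟧)
  coefficient = trans (cong (λ z → c * (⟦ suc k ⟧ * z)) (DivisorSeries.coefficient u-series k))
                      (solve 4 (λ c a N s → c :* (N :* (a :* s)) := c :* a :* (N :* s)) refl c α ⟦ suc k ⟧ ⟦ σ r (suc k) ⟧)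

CP-X₄₂ : CompletelyPositive X₄₂
CP-X₄₂ = CP-≈ X₄₂≈D-E₂ (CP-D-DivisorSeries (- (+ 1 / 24)) E₂-DivisorSeries (nonNeg! _))

CP-X₆₁ : CompletelyPositive X₆₁
CP-X₆₁ = CP-≈ X₆₁≈D-E₄ (CP-D-DivisorSeries (+ 1 / 240) E₄-DivisorSeries (nonNeg! _))

CP-X₈₁ : CompletelyPositive X₈₁
CP-X₈₁ = CP-≈ X₈₁≈D-E₆ (CP-D-DivisorSeries (- (+ 1 / 504)) E₆-DivisorSeries (nonNeg! _))

CP-X₈₂ : CompletelyPositive X₈₂
CP-X₈₂ = CP-from-D D-X₈₂ (CP-⊗ (CP-· ⟦ 2 ⟧ (nonNeg! _) CP-X₄₂) CP-X₆₁) (nonNeg! _)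

CP-X₁₀₂ : CompletelyPositive X₁₀₂
CP-X₁₀₂ = CP-from-D D-X₁₀₂ (CP-⊕ (CP-⊗ (CP-· (+ 8 / 9) (nonNeg! _) CP-X₄₂) CP-X₈₁)
                                 (CP-⊗ (CP-· (+ 10 / 9) (nonNeg! _) CP-X₆₁) CP-X₆₁))
                         (nonNeg! _)

CP-X₁₂₂ : CompletelyPositive X₁₂₂
CP-X₁₂₂ = CP-from-D D-X₁₂₂ (CP-⊗ (CP-· ⟦ 3 ⟧ (nonNeg! _) CP-X₆₁) CP-X₈₂) (nonNeg! _)

CP-X₁₂₁ : CompletelyPositive X₁₂₁
CP-X₁₂₁ = CP-from-D D-X₁₂₁ (CP-⊗ (CP-· ⟦ 2 ⟧ (nonNeg! _) CP-X₆₁) CP-X₈₁) (nonNeg! _)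

CP-X₁₄₂ : CompletelyPositive X₁₄₂
CP-X₁₄₂ = CP-from-D D-X₁₄₂ (CP-⊗ (CP-· ⟦ 3 ⟧ (nonNeg! _) CP-X₄₂) CP-X₁₂₁) (nonNeg! _)

proposition4p6 : (D X₈₂ ≋ (⟦ 2 ⟧ · X₄₂ ⊗ X₆₁))
    × (D X₁₀₂ ≋ ((+ 8 / 9) · X₄₂ ⊗ X₈₁ ⊕ (+ 10 / 9) · X₆₁ ⊗ X₆₁))
    × (D X₁₂₂ ≋ (⟦ 3 ⟧ · X₆₁ ⊗ X₈₂))
    × (D X₁₄₂ ≋ (⟦ 3 ⟧ · X₄₂ ⊗ X₁₂₁))
    × (CompletelyPositive X₄₂ × CompletelyPositive X₈₂ × CompletelyPositive X₁₀₂
       × CompletelyPositive X₁₂₂ × CompletelyPositive X₁₄₂)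
proposition4p6 = coeffwise D-X₈₂ , coeffwise D-X₁₀₂ , coeffwise D-X₁₂₂ , coeffwise D-X₁₄₂
               , CP-X₄₂ , CP-X₈₂ , CP-X₁₀₂ , CP-X₁₂₂ , CP-X₁₄₂
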